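{- Let $0\le k\le n\le m$ be integers with $n\ge1$, and let $\lambda$ be a partition inside the $n\times m$ board. For $1\le i\le n$ let $\lambda^{r}_i$ be the partition obtained from $\lambda$ by removing its $i$th row ($\lambda^{r}_i=\lambda$ if $i>\ell(\lambda)$), viewed inside the $(n-1)\times m$ board. Then \[ [m-n+1]\sum_{i=1}^n q^{i-1}H^{m,n-1}_k(\lambda^{r}_i)=H^{m,n}_k(\lambda)\,q^k[n-k]+H^{m,n}_{k+1}(\lambda)\,[k+1]. \]
   Context: $q$ is an indeterminate; $[x]=(1-q^x)/(1-q)$, $[n]_k=[n][n-1]\cdots[n-k+1]$ ($[n]_0=1$), $[n]!=[n]_n$, $(a;q)_k=\prod_{i=0}^{k-1}(1-aq^i)$. A partition $\lambda$ is identified with its Ferrers board (rows from the top, columns from the left, row $i$ having $\lambda_i$ cells); $|\lambda|$ is its number of cells; $\lambda$ is inside the $n\times m$ board if $\ell(\lambda)\le n$, $\lambda_1\le m$. $R_k(\lambda)=\sum_p q^{\mathrm{inv}(p)}$ over placements of $k$ non-attacking rooks on $\lambda$, with $\mathrm{inv}(p)$ the number of cells of $\lambda$ having no rook and neither to the left of a rook in the same row nor above a rook in the same column. For $m\ge n$ and $\lambda$ inside the $n\times m$ board, $H^{m,n}_i(\lambda)$ ($0\le i\le n$) are defined by $\sum_{i=0}^n H^{m,n}_i(\lambda)x^i=\frac{q^{ -|\lambda|}}{[m-n]!}\sum_{i=0}^n R_i(\lambda)[m-i]!(-1)^iq^{mi-\binom i2}(x;q)_i$, and $H^{m,n}_i(\lambda)=0$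 for $i<0$ or $i>n$. -}

module Defs where

open import Data.Nat using (ℕ; zero; suc; _+_; _*_; _∸_; _≤_; _<ᵇ_; _≡ᵇ_)
open import Data.Integer using (ℤ; +_) renaming (_+_ to _+ℤ_; _*_ to _*ℤ_; -_ to -ℤ_)
open import Data.Bool using (Bool; true; false; not; _∧_; _∨_; if_then_else_)
open import Data.List using (List; []; _∷_; _++_; map; concatMap; upTo; filterᵇ; foldr; length; replicate)
open import Data.Bool.ListAction using (any)
open import Data.Product using (_×_; _,_)
open import Data.Fin using (Fin; toℕ)
open import Data.Vec using (Vec; toList; removeAt)
import Data.Vec as V
open import Relation.Binary.PropositionalEquality using (_≡_)

-- Polynomials in q with integer coefficients: coefficient lists,
-- constant term first.  Equality is coefficientwise (trailing zeros
-- are irrelevant).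

Poly : Set
Poly = List ℤ

coeff : Poly → ℕ → ℤ
coeff []       _       = + 0
coeff (a ∷ p)  zero    = a
coeff (a ∷ p)  (suc d) = coeff p d

_≈P_ : Poly → Poly → Set
p ≈P r = ∀ d → coeff p d ≡ coeff r d

infixl 6 _+P_
infixl 7 _*P_ _·P_

_+P_ : Poly → Poly → Poly
[]      +P r       = r
(a ∷ p) +P []      = a ∷ p
(a ∷ p) +P (b ∷ r) = (a +ℤ b) ∷ (p +P r)

_·P_ : ℤ → Poly → Poly
c ·P p = map (c *ℤ_) p

_*P_ : Poly → Poly → Poly
[]      *P r = []
(a ∷ p) *P r = (a ·P r) +P (+ 0 ∷ (p *P r))

-P_ : Poly → Poly
-P p = (-ℤ (+ 1)) ·P p

0P 1P : Poly
0P = []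
1P = + 1 ∷ []

qpow : ℕ → Poly
qpow k = replicate k (+ 0) ++ (+ 1 ∷ [])

qint : ℕ → Poly
qint x = replicate x (+ 1)

qfact : ℕ → Poly
qfact zero    = 1P
qfact (suc n) = qint (suc n) *P qfact n

sgn : ℕ → ℤ
sgn zero          = + 1
sgn (suc zero)    = -ℤ (+ 1)
sgn (suc (suc i)) = sgn i

choose2 : ℕ → ℕ
choose2 zero    = 0
choose2 (suc i) = i + choose2 i

-- Polynomials in x whose coefficients are polynomials in q.

XPoly : Set
XPoly = List Poly

_+X_ : XPoly → XPoly → XPoly
[]      +X r       = r
(a ∷ p) +X []      = a ∷ p
(a ∷ p) +X (b ∷ r) = (a +P b) ∷ (p +X r)

_·X_ : Poly → XPoly → XPoly
c ·X p = map (c *P_) p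

_*X_ : XPoly → XPoly → XPoly
[]      *X r = []
(a ∷ p) *X r = (a ·X r) +X (0P ∷ (p *X r))

coeffX : XPoly → ℕ → Poly
coeffX []      _       = 0P
coeffX (a ∷ p) zero    = a
coeffX (a ∷ p) (suc d) = coeffX p d

qpoch : ℕ → XPoly
qpoch zero    = 1P ∷ []
qpoch (suc i) = qpoch i *X (1P ∷ (-P qpow i) ∷ [])

-- Rational functions in q: formal fractions num/den, compared by
-- cross-multiplication (all denominators used below are nonzero).

record Frac : Set where
  constructor _/_
  field
    num : Poly
    den : Poly
open Frac public

infix 4 _≈F_
_≈F_ : Frac → Frac → Set
a ≈F b = (num a *P den b) ≈P (num b *P den a)

infixl 6 _+F_
infixl 7 _⋆F_

_+F_ : Frac → Frac → Frac
(a / b) +F (c / d) = ((a *P d) +P (c *P b)) / (b *P d)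

_⋆F_ : Poly → Frac → Frac
p ⋆F (a / b) = (p *P a) / b

0F : Frac
0F = 0P / 1P

sumF : List Frac → Frac
sumF = foldr _+F_ 0F

-- Partitions inside the n × m board: weakly decreasing row lengths
-- λ_1 ≥ ... ≥ λ_n ≥ 0 (rows beyond ℓ(λ) have length 0), all ≤ m.

Decreasing : ∀ {n} → Vec ℕ n → Set
Decreasing V.[]             = Data.Unit.⊤ where import Data.Unit
Decreasing (a V.∷ V.[])     = Data.Unit.⊤ where import Data.Unit
Decreasing (a V.∷ b V.∷ v)  = (b ≤ a) × Decreasing (b V.∷ v)

AllLe : ∀ {n} → ℕ → Vec ℕ n → Set
AllLe m V.[]       = Data.Unit.⊤ where import Data.Unit
AllLe m (a V.∷ v)  = (a ≤ m) × AllLe m v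

InsideBoard : (n m : ℕ) → Vec ℕ n → Set
InsideBoard n m λ' = Decreasing λ' × AllLe m λ'

size : ∀ {n} → Vec ℕ n → ℕ
size = V.sum

-- the partition with its i-th row removed (0-based index i)
removeRow : ∀ {n} → Vec ℕ (suc n) → Fin (suc n) → Vec ℕ n
removeRow = removeAt

-- Rook placements.  Cells are (row , column), 0-based, row r having
-- columns 0 .. λ_r - 1.  A placement is a list of rook cells.

Cell : Set
Cell = ℕ × ℕ

memℕ : ℕ → List ℕ → Bool
memℕ c []       = false
memℕ c (d ∷ ds) = (c ≡ᵇ d) ∨ memℕ c ds

placementsFrom : ℕ → List ℕ → List ℕ → List (List Cell)
placementsFrom r used []       = [] ∷ []
placementsFrom r used (l ∷ ls) =
  placementsFrom (suc r) used ls ++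
  concatMap (λ c → map ((r , c) ∷_) (placementsFrom (suc r) (c ∷ used) ls))
            (filterᵇ (λ c → not (memℕ c used)) (upTo l))

placements : List ℕ → List (List Cell)
placements = placementsFrom 0 []

cellsFrom : ℕ → List ℕ → List Cell
cellsFrom r []       = []
cellsFrom r (l ∷ ls) = map (r ,_) (upTo l) ++ cellsFrom (suc r) ls

cells : List ℕ → List Cell
cells = cellsFrom 0

counted : List Cell → Cell → Bool
counted p (r , c) =
  not (any (λ { (r' , c') →
          ((r ≡ᵇ r') ∧ (c ≡ᵇ c')) ∨ ((r ≡ᵇ r') ∧ (c <ᵇ c')) ∨ ((c ≡ᵇ c') ∧ (r <ᵇ r')) }) p)

inv : List ℕ → List Cell → ℕ
inv rows p = length (filterᵇ (counted p) (cells rows))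

rookPoly : ∀ {n} → ℕ → Vec ℕ n → Poly
rookPoly k λ' =
  foldr _+P_ 0P (map (λ p → qpow (inv (toList λ') p))
                     (filterᵇ (λ p → length p ≡ᵇ k) (placements (toList λ'))))

-- H^{m,n}_i(λ), for λ inside the n × m board (m ≥ n):
--   Σ_i H_i x^i = q^{-|λ|}/[m-n]! Σ_{i=0}^n R_i [m-i]! (-1)^i q^{mi - C(i,2)} (x;q)_i
-- represented as the fraction (coefficient of x^i of the sum) / (q^{|λ|} [m-n]!).
-- For i > n the coefficient is 0 automatically.

HSum : (m n : ℕ) → Vec ℕ n → XPoly
HSum m n λ' =
  foldr _+X_ []
    (map (λ i → ((sgn i ·P ((rookPoly i λ' *P qfact (m ∸ i)) *P qpow (m * i ∸ choose2 i)))) ·X qpoch i)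
         (upTo (suc n)))

H : (m n : ℕ) → Vec ℕ n → ℕ → Frac
H m n λ' i = coeffX (HSum m n λ') i / (qpow (size λ') *P qfact (m ∸ n))

module Submission where

-- Clearing the denominator q^|λ| [m-n]!, the generating function Σ_i H^{m,n}_i(λ) x^i
-- becomes Σ_j w_j R_j(λ) (x;q)_j with w_j = (-1)^j [m-j]! q^(mj - C(j,2)).  Writing
-- c_{j,k} for the coefficient of x^k in (x;q)_j, the recursion (x;q)_{j+1} = (x;q)_j (1 - x q^j)
-- gives [k+1] c_{j,k+1} = -q^k [j-k] c_{j,k}, hence for j ≤ n
--   q^k [n-k] c_{j,k} + [k+1] c_{j,k+1} = q^j [n-j] c_{j,k},
-- so the right-hand side of the theorem is Σ_j w_j c_{j,k} q^j [n-j] R_j(λ).  On the left,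
-- |λ| = λ_i + |λ^r_i| and [m-n+1] [m-n]! = [m-n+1]!, so everything reduces to the row-removal
-- identity  Σ_i q^(i-1) q^(λ_i) R_j(λ^r_i) = q^j [n-j] R_j(λ).  That identity follows by
-- induction on the number of rows from the first-row recursion
--   R_j(λ) = q^(λ_1 - j) R_j(λ') + [λ_1 - j + 1] R_{j-1}(λ')      (λ' = λ without its first row),
-- obtained by sorting placements by the column c of the rook in the first row, if any: the
-- free cells of the first row are then the λ_1 - j free columns, resp. the free columns right
-- of c, and summing q^(number of free columns right of c) over the free c gives a q-integer.

open import Defs
open import Data.Nat using (ℕ; zero; suc; _+_; _*_; _∸_; _≤_; _<_; _≥_; z≤n; s≤s; _≤?_; _≡ᵇ_; _<ᵇ_)
import Data.Nat.Properties as ℕ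
open import Data.Integer using (ℤ; +_) renaming (_+_ to _+ℤ_; _*_ to _*ℤ_; -_ to -ℤ_; _≟_ to _≟ℤ_)
import Data.Integer.Properties as ℤ
import Data.Integer.Tactic.RingSolver as ℤ-Solver
open import Data.Bool using (Bool; true; false; not; _∧_; _∨_; if_then_else_; T?)
import Data.Bool.Properties as Bool
open import Data.List using (List; []; _∷_; _++_; map; concatMap; filterᵇ; foldr; length; upTo; allFin)
import Data.List.Properties as List
open import Data.List.Relation.Unary.All as All using (All; []; _∷_)
open import Data.List.Relation.Unary.AllPairs using (AllPairs; []; _∷_)
import Data.List.Relation.Unary.All.Properties as All
open import Data.Maybe using (Maybe; just; nothing)
open import Data.Product using (_×_; _,_; proj₁; proj₂)
open import Data.Unit using (⊤; tt)
open import Data.Fin using (Fin; toℕ) renaming (zero to fzero; suc to fsuc)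
open import Data.Vec using (Vec; toList; removeAt; lookup) renaming ([] to []ᵥ; _∷_ to _∷ᵥ_)
import Data.Vec.Properties as Vec
open import Function using (_∘_; id)
open import Relation.Binary using (IsEquivalence)
open import Relation.Binary.PropositionalEquality using (_≡_; refl; sym; trans; cong; cong₂; module ≡-Reasoning)
open import Relation.Nullary using (¬_; yes; no; contradiction)
open import Algebra.Bundles using (CommutativeRing)
open import Algebra.Structures using (IsCommutativeRing)
open import Tactic.RingSolver using (solve-∀)
import Tactic.RingSolver.Core.AlmostCommutativeRing as ACR
import Relation.Binary.Reasoning.Setoid as SetoidReasoning

private variable A B : Set

-- Polynomials form a commutative ring

hd : Poly → ℤ
hd []      = + 0
hd (a ∷ _) = a

tl : Poly → Poly
tl []      = []
tl (_ ∷ p) = p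

coeff-zero : ∀ p → coeff p 0 ≡ hd p
coeff-zero []      = refl
coeff-zero (a ∷ p) = refl

coeff-suc : ∀ p d → coeff p (suc d) ≡ coeff (tl p) d
coeff-suc []      d = refl
coeff-suc (a ∷ p) d = refl

coeff-+P : ∀ p r d → coeff (p +P r) d ≡ coeff p d +ℤ coeff r d
coeff-+P []      r       d       = sym (ℤ.+-identityˡ _)
coeff-+P (a ∷ p) []      d       = sym (ℤ.+-identityʳ _)
coeff-+P (a ∷ p) (b ∷ r) zero    = refl
coeff-+P (a ∷ p) (b ∷ r) (suc d) = coeff-+P p r d

coeff-·P : ∀ c p d → coeff (c ·P p) d ≡ c *ℤ coeff p d
coeff-·P c []      d       = sym (ℤ.*-zeroʳ c)
coeff-·P c (a ∷ p) zero    = refl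
coeff-·P c (a ∷ p) (suc d) = coeff-·P c p d

coeff-*P-zero : ∀ p r → coeff (p *P r) 0 ≡ hd p *ℤ hd r
coeff-*P-zero []      r = refl
coeff-*P-zero (a ∷ p) r = begin
  coeff ((a ·P r) +P (+ 0 ∷ (p *P r))) 0        ≡⟨ coeff-+P (a ·P r) _ 0 ⟩
  coeff (a ·P r) 0 +ℤ coeff (+ 0 ∷ (p *P r)) 0 ≡⟨ ℤ.+-identityʳ _ ⟩
  coeff (a ·P r) 0                              ≡⟨ coeff-·P a r 0 ⟩
  a *ℤ coeff r 0                                ≡⟨ cong (a *ℤ_) (coeff-zero r) ⟩
  a *ℤ hd r                                     ∎
  where open ≡-Reasoning

coeff-*P-suc : ∀ p r d → coeff (p *P r) (suc d) ≡ hd p *ℤ coeff (tl r) d +ℤ coeff (tl p *P r) d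
coeff-*P-suc []      r d = refl
coeff-*P-suc (a ∷ p) r d =
  trans (coeff-+P (a ·P r) (+ 0 ∷ (p *P r)) (suc d))
        (cong (_+ℤ coeff (p *P r) d) (trans (coeff-·P a r (suc d)) (cong (a *ℤ_) (coeff-suc r d))))

≈P-refl : ∀ {p} → p ≈P p
≈P-refl d = refl

≈P-sym : ∀ {p r} → p ≈P r → r ≈P p
≈P-sym e d = sym (e d)

≈P-trans : ∀ {p r s} → p ≈P r → r ≈P s → p ≈P s
≈P-trans e f d = trans (e d) (f d)

hd-cong : ∀ {p r} → p ≈P r → hd p ≡ hd r
hd-cong {p} {r} e = trans (sym (coeff-zero p)) (trans (e 0) (coeff-zero r))

tl-cong : ∀ {p r} → p ≈P r → tl p ≈P tl r
tl-cong {p} {r} e d = trans (sym (coeff-suc p d)) (trans (e (suc d)) (coeff-suc r d))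

∷-cong : ∀ {a b p r} → a ≡ b → p ≈P r → (a ∷ p) ≈P (b ∷ r)
∷-cong e f zero    = e
∷-cong e f (suc d) = f d

η-hd-tl : ∀ p → p ≈P (hd p ∷ tl p)
η-hd-tl []      zero    = refl
η-hd-tl []      (suc d) = refl
η-hd-tl (a ∷ p) d       = refl

+P-cong : ∀ {p p′ r r′} → p ≈P p′ → r ≈P r′ → (p +P r) ≈P (p′ +P r′)
+P-cong {p} {p′} {r} {r′} e f d =
  trans (coeff-+P p r d) (trans (cong₂ _+ℤ_ (e d) (f d)) (sym (coeff-+P p′ r′ d)))

·P-cong : ∀ {c p p′} → p ≈P p′ → (c ·P p) ≈P (c ·P p′)
·P-cong {c} {p} {p′} e d = trans (coeff-·P c p d) (trans (cong (c *ℤ_) (e d)) (sym (coeff-·P c p′ d)))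

*P-cong : ∀ {p p′ r r′} → p ≈P p′ → r ≈P r′ → (p *P r) ≈P (p′ *P r′)
*P-cong {p} {p′} {r} {r′} e f zero =
  trans (coeff-*P-zero p r) (trans (cong₂ _*ℤ_ (hd-cong {p} {p′} e) (hd-cong {r} {r′} f)) (sym (coeff-*P-zero p′ r′)))
*P-cong {p} {p′} {r} {r′} e f (suc d) =
  trans (coeff-*P-suc p r d)
    (trans (cong₂ _+ℤ_ (cong₂ _*ℤ_ (hd-cong {p} {p′} e) (tl-cong {r} {r′} f d))
                       (*P-cong {tl p} {tl p′} {r} {r′} (tl-cong {p} {p′} e) f d))
           (sym (coeff-*P-suc p′ r′ d)))

hd-+P : ∀ p r → hd (p +P r) ≡ hd p +ℤ hd r
hd-+P p r = trans (sym (coeff-zero (p +P r))) (trans (coeff-+P p r 0) (cong₂ _+ℤ_ (coeff-zero p) (coeff-zero r)))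

hd-·P : ∀ c p → hd (c ·P p) ≡ c *ℤ hd p
hd-·P c []      = sym (ℤ.*-zeroʳ c)
hd-·P c (a ∷ p) = refl

hd-*P : ∀ p r → hd (p *P r) ≡ hd p *ℤ hd r
hd-*P p r = trans (sym (coeff-zero (p *P r))) (coeff-*P-zero p r)

tl-+P : ∀ p r → tl (p +P r) ≈P (tl p +P tl r)
tl-+P p r d = begin
  coeff (tl (p +P r)) d           ≡⟨ sym (coeff-suc (p +P r) d) ⟩
  coeff (p +P r) (suc d)          ≡⟨ coeff-+P p r (suc d) ⟩
  coeff p (suc d) +ℤ coeff r (suc d) ≡⟨ cong₂ _+ℤ_ (coeff-suc p d) (coeff-suc r d) ⟩
  coeff (tl p) d +ℤ coeff (tl r) d ≡⟨ sym (coeff-+P (tl p) (tl r) d) ⟩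
  coeff (tl p +P tl r) d          ∎
  where open ≡-Reasoning

tl-·P : ∀ c p → tl (c ·P p) ≈P (c ·P tl p)
tl-·P c []      d = refl
tl-·P c (a ∷ p) d = refl

tl-*P : ∀ p r → tl (p *P r) ≈P ((hd p ·P tl r) +P (tl p *P r))
tl-*P p r d = begin
  coeff (tl (p *P r)) d                                 ≡⟨ sym (coeff-suc (p *P r) d) ⟩
  coeff (p *P r) (suc d)                                ≡⟨ coeff-*P-suc p r d ⟩
  hd p *ℤ coeff (tl r) d +ℤ coeff (tl p *P r) d         ≡⟨ cong (_+ℤ coeff (tl p *P r) d) (sym (coeff-·P (hd p) (tl r) d)) ⟩
  coeff (hd p ·P tl r) d +ℤ coeff (tl p *P r) d         ≡⟨ sym (coeff-+P (hd p ·P tl r) (tl p *P r) d) ⟩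
  coeff ((hd p ·P tl r) +P (tl p *P r)) d               ∎
  where open ≡-Reasoning

+P-assoc : ∀ p r s → ((p +P r) +P s) ≈P (p +P (r +P s))
+P-assoc p r s d rewrite coeff-+P (p +P r) s d | coeff-+P p r d | coeff-+P p (r +P s) d | coeff-+P r s d =
  ℤ.+-assoc (coeff p d) (coeff r d) (coeff s d)

+P-comm : ∀ p r → (p +P r) ≈P (r +P p)
+P-comm p r d rewrite coeff-+P p r d | coeff-+P r p d = ℤ.+-comm (coeff p d) (coeff r d)

+P-identityˡ : ∀ p → (0P +P p) ≈P p
+P-identityˡ p d = refl

+P-identityʳ : ∀ p → (p +P 0P) ≈P p
+P-identityʳ p d rewrite coeff-+P p [] d = ℤ.+-identityʳ (coeff p d)

-P-inverseʳ : ∀ p → (p +P (-P p)) ≈P 0P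
-P-inverseʳ p d rewrite coeff-+P p (-P p) d | coeff-·P (-ℤ (+ 1)) p d = x-x≡0 (coeff p d)
  where
  x-x≡0 : ∀ x → x +ℤ (-ℤ (+ 1)) *ℤ x ≡ + 0
  x-x≡0 = ℤ-Solver.solve-∀

-P-inverseˡ : ∀ p → ((-P p) +P p) ≈P 0P
-P-inverseˡ p = ≈P-trans {(-P p) +P p} {p +P (-P p)} {0P} (+P-comm (-P p) p) (-P-inverseʳ p)

*P-zeroʳ : ∀ p → (p *P 0P) ≈P 0P
*P-zeroʳ p zero = trans (coeff-*P-zero p []) (ℤ.*-zeroʳ (hd p))
*P-zeroʳ p (suc d) rewrite coeff-*P-suc p [] d | *P-zeroʳ (tl p) d | ℤ.*-zeroʳ (hd p) = refl

*P-distribʳ : ∀ p r s → ((p +P r) *P s) ≈P ((p *P s) +P (r *P s))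
*P-distribʳ p r s zero
  rewrite coeff-*P-zero (p +P r) s | coeff-+P (p *P s) (r *P s) 0 | coeff-*P-zero p s | coeff-*P-zero r s | hd-+P p r =
  ℤ.*-distribʳ-+ (hd s) (hd p) (hd r)
*P-distribʳ p r s (suc d)
  rewrite coeff-*P-suc (p +P r) s d | coeff-+P (p *P s) (r *P s) (suc d) | coeff-*P-suc p s d | coeff-*P-suc r s d | hd-+P p r
        | *P-cong {tl (p +P r)} {tl p +P tl r} {s} {s} (tl-+P p r) (≈P-refl {s}) d | *P-distribʳ (tl p) (tl r) s d | coeff-+P (tl p *P s) (tl r *P s) d =
  regroup (hd p) (hd r) (coeff (tl s) d) (coeff (tl p *P s) d) (coeff (tl r *P s) d)
  where
  regroup : ∀ a b x u v → (a +ℤ b) *ℤ x +ℤ (u +ℤ v) ≡ (a *ℤ x +ℤ u) +ℤ (b *ℤ x +ℤ v)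
  regroup = ℤ-Solver.solve-∀

·P-*P : ∀ c p r → (c ·P (p *P r)) ≈P ((c ·P p) *P r)
·P-*P c p r zero rewrite coeff-·P c (p *P r) 0 | coeff-*P-zero p r | coeff-*P-zero (c ·P p) r | hd-·P c p =
  sym (ℤ.*-assoc c (hd p) (hd r))
·P-*P c p r (suc d)
  rewrite coeff-·P c (p *P r) (suc d) | coeff-*P-suc p r d | coeff-*P-suc (c ·P p) r d | hd-·P c p
        | *P-cong {tl (c ·P p)} {c ·P tl p} {r} {r} (tl-·P c p) (≈P-refl {r}) d | sym (·P-*P c (tl p) r d) | coeff-·P c (tl p *P r) d =
  distrib c (hd p) (coeff (tl r) d) (coeff (tl p *P r) d)
  where
  distrib : ∀ c a x y → c *ℤ (a *ℤ x +ℤ y) ≡ (c *ℤ a) *ℤ x +ℤ c *ℤ y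
  distrib = ℤ-Solver.solve-∀

*P-assoc : ∀ p r s → ((p *P r) *P s) ≈P (p *P (r *P s))
*P-assoc p r s zero rewrite coeff-*P-zero (p *P r) s | coeff-*P-zero p (r *P s) | hd-*P p r | hd-*P r s =
  ℤ.*-assoc (hd p) (hd r) (hd s)
*P-assoc p r s (suc d)
  rewrite coeff-*P-suc (p *P r) s d | coeff-*P-suc p (r *P s) d | hd-*P p r
        | *P-cong {tl (p *P r)} {(hd p ·P tl r) +P (tl p *P r)} {s} {s} (tl-*P p r) (≈P-refl {s}) d
        | *P-distribʳ (hd p ·P tl r) (tl p *P r) s d | coeff-+P ((hd p ·P tl r) *P s) ((tl p *P r) *P s) d
        | *P-assoc (tl p) r s d | sym (·P-*P (hd p) (tl r) s d) | coeff-·P (hd p) (tl r *P s) d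
        | sym (coeff-suc (r *P s) d) | coeff-*P-suc r s d =
  regroup (hd p) (hd r) (coeff (tl s) d) (coeff (tl r *P s) d) (coeff (tl p *P (r *P s)) d)
  where
  regroup : ∀ a b x y z → (a *ℤ b) *ℤ x +ℤ (a *ℤ y +ℤ z) ≡ a *ℤ (b *ℤ x +ℤ y) +ℤ z
  regroup = ℤ-Solver.solve-∀

*P-∷ʳ : ∀ p b r → (p *P (b ∷ r)) ≈P ((b ·P p) +P (+ 0 ∷ (p *P r)))
*P-∷ʳ p b r zero rewrite coeff-*P-zero p (b ∷ r) | coeff-+P (b ·P p) (+ 0 ∷ (p *P r)) 0 | coeff-·P b p 0 | coeff-zero p =
  trans (ℤ.*-comm (hd p) b) (sym (ℤ.+-identityʳ (b *ℤ hd p)))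
*P-∷ʳ p b r (suc d)
  rewrite coeff-*P-suc p (b ∷ r) d | coeff-+P (b ·P p) (+ 0 ∷ (p *P r)) (suc d) | coeff-·P b p (suc d) | coeff-suc p d
        | *P-∷ʳ (tl p) b r d | coeff-+P (b ·P tl p) (+ 0 ∷ (tl p *P r)) d | coeff-·P b (tl p) d
        | *P-cong {p} {hd p ∷ tl p} {r} {r} (η-hd-tl p) (≈P-refl {r}) d | coeff-+P (hd p ·P r) (+ 0 ∷ (tl p *P r)) d | coeff-·P (hd p) r d =
  regroup (hd p) b (coeff (tl p) d) (coeff r d) (coeff (+ 0 ∷ (tl p *P r)) d)
  where
  regroup : ∀ h b t x y → h *ℤ x +ℤ (b *ℤ t +ℤ y) ≡ b *ℤ t +ℤ (h *ℤ x +ℤ y)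
  regroup = ℤ-Solver.solve-∀

*P-comm : ∀ p r → (p *P r) ≈P (r *P p)
*P-comm []      r = ≈P-sym {r *P []} {[]} (*P-zeroʳ r)
*P-comm (a ∷ p) r =
  ≈P-trans {(a ∷ p) *P r} {(a ·P r) +P (+ 0 ∷ (r *P p))} {r *P (a ∷ p)}
    (+P-cong {a ·P r} {a ·P r} {+ 0 ∷ (p *P r)} {+ 0 ∷ (r *P p)} (≈P-refl {a ·P r}) (∷-cong refl (*P-comm p r)))
    (≈P-sym {r *P (a ∷ p)} {(a ·P r) +P (+ 0 ∷ (r *P p))} (*P-∷ʳ r a p))

coeff-0∷[] : ∀ d → coeff (+ 0 ∷ []) d ≡ + 0
coeff-0∷[] zero    = refl
coeff-0∷[] (suc d) = refl

*P-identityˡ : ∀ p → (1P *P p) ≈P p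
*P-identityˡ p d rewrite coeff-+P ((+ 1) ·P p) (+ 0 ∷ []) d | coeff-·P (+ 1) p d | coeff-0∷[] d =
  trans (ℤ.+-identityʳ _) (ℤ.*-identityˡ _)

*P-identityʳ : ∀ p → (p *P 1P) ≈P p
*P-identityʳ p = ≈P-trans {p *P 1P} {1P *P p} {p} (*P-comm p 1P) (*P-identityˡ p)

*P-distribˡ : ∀ p r s → (p *P (r +P s)) ≈P ((p *P r) +P (p *P s))
*P-distribˡ p r s =
  ≈P-trans {p *P (r +P s)} {(r +P s) *P p} {(p *P r) +P (p *P s)} (*P-comm p (r +P s))
    (≈P-trans {(r +P s) *P p} {(r *P p) +P (s *P p)} {(p *P r) +P (p *P s)} (*P-distribʳ r s p)
      (+P-cong {r *P p} {p *P r} {s *P p} {p *P s} (*P-comm r p) (*P-comm s p)))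

-- A record wrapper around _≈P_: unlike the function type p ≈P r, it
-- determines p and r, so they can be inferred from a proof.
infix 4 _≋_
record _≋_ (p r : Poly) : Set where
  constructor mk
  field get : p ≈P r
open _≋_ public

≋-isEquivalence : IsEquivalence _≋_
≋-isEquivalence = record
  { refl  = λ {p} → mk (≈P-refl {p})
  ; sym   = λ {p} {r} (mk e) → mk (≈P-sym {p} {r} e)
  ; trans = λ {p} {r} {s} (mk e) (mk f) → mk (≈P-trans {p} {r} {s} e f)
  }

Poly-isCommutativeRing : IsCommutativeRing _≋_ _+P_ _*P_ -P_ 0P 1P
Poly-isCommutativeRing = record
  { isRing = record
    { +-isAbelianGroup = record
      { isGroup = record
        { isMonoid = record
          { isSemigroup = record
            { isMagma = record
              { isEquivalence = ≋-isEquivalence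
              ; ∙-cong = λ {p} {p′} {r} {r′} (mk e) (mk f) → mk (+P-cong {p} {p′} {r} {r′} e f) }
            ; assoc = λ p r s → mk (+P-assoc p r s) }
          ; identity = (λ p → mk (+P-identityˡ p)) , (λ p → mk (+P-identityʳ p)) }
        ; inverse = (λ p → mk (-P-inverseˡ p)) , (λ p → mk (-P-inverseʳ p))
        ; ⁻¹-cong = λ {p} {p′} (mk e) → mk (·P-cong { -ℤ (+ 1)} {p} {p′} e) }
      ; comm = λ p r → mk (+P-comm p r) }
    ; *-cong = λ {p} {p′} {r} {r′} (mk e) (mk f) → mk (*P-cong {p} {p′} {r} {r′} e f)
    ; *-assoc = λ p r s → mk (*P-assoc p r s)
    ; *-identity = (λ p → mk (*P-identityˡ p)) , (λ p → mk (*P-identityʳ p))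
    ; distrib = (λ p r s → mk (*P-distribˡ p r s)) , (λ p r s → mk (*P-distribʳ r s p)) }
  ; *-comm = λ p r → mk (*P-comm p r)
  }

Poly-commutativeRing : CommutativeRing _ _
Poly-commutativeRing = record { isCommutativeRing = Poly-isCommutativeRing }

isZero? : (p : Poly) → Maybe (0P ≋ p)
isZero? []      = just (mk (≈P-refl {[]}))
isZero? (a ∷ p) with a ≟ℤ + 0 | isZero? p
... | yes refl | just (mk e) = just (mk (λ { zero → refl ; (suc d) → e d }))
... | _        | _           = nothing

Poly-ring : ACR.AlmostCommutativeRing _ _
Poly-ring = ACR.fromCommutativeRing Poly-commutativeRing isZero?

open CommutativeRing Poly-commutativeRing
  using (+-cong; +-congˡ; +-congʳ; +-comm; +-assoc; +-identityˡ; +-identityʳ; -‿cong;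
         *-cong; *-congˡ; *-congʳ; *-comm; *-assoc; *-identityˡ; *-identityʳ; zeroˡ; zeroʳ; distribˡ)
  renaming (setoid to Poly-setoid; refl to ≋-refl; sym to ≋-sym; trans to ≋-trans)

≡⇒≋ : ∀ {p r} → p ≡ r → p ≋ r
≡⇒≋ refl = ≋-refl

module ≋-Reasoning = SetoidReasoning Poly-setoid

∑ : List A → (A → Poly) → Poly
∑ xs f = foldr _+P_ 0P (map f xs)

syntax ∑ xs (λ x → e) = ∑[ x ∈ xs ] e

when : Bool → Poly → Poly
when true  p = p
when false p = 0P

∑-cong : (xs : List A) {f g : A → Poly} → (∀ x → f x ≋ g x) → ∑ xs f ≋ ∑ xs g
∑-cong []       e = ≋-refl
∑-cong (x ∷ xs) e = +-cong (e x) (∑-cong xs e)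

∑-cong-All : {xs : List A} {f g : A → Poly} → All (λ x → f x ≋ g x) xs → ∑ xs f ≋ ∑ xs g
∑-cong-All []       = ≋-refl
∑-cong-All (e ∷ es) = +-cong e (∑-cong-All es)

∑-++ : (xs ys : List A) (f : A → Poly) → ∑ (xs ++ ys) f ≋ ∑ xs f +P ∑ ys f
∑-++ []       ys f = ≋-sym (+-identityˡ (∑ ys f))
∑-++ (x ∷ xs) ys f = ≋-trans (+-congˡ (∑-++ xs ys f)) (≋-sym (+-assoc (f x) (∑ xs f) (∑ ys f)))

∑-map : (xs : List A) (h : A → B) (f : B → Poly) → ∑ (map h xs) f ≡ ∑ xs (f ∘ h)
∑-map []       h f = refl
∑-map (x ∷ xs) h f = cong (f (h x) +P_) (∑-map xs h f)

∑-concatMap : (xs : List A) (g : A → List B) (f : B → Poly) →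
              ∑ (concatMap g xs) f ≋ ∑[ x ∈ xs ] ∑ (g x) f
∑-concatMap []       g f = ≋-refl
∑-concatMap (x ∷ xs) g f = ≋-trans (∑-++ (g x) (concatMap g xs) f) (+-congˡ (∑-concatMap xs g f))

∑-zero : (xs : List A) {f : A → Poly} → (∀ x → f x ≋ 0P) → ∑ xs f ≋ 0P
∑-zero []       e = ≋-refl
∑-zero (x ∷ xs) e = ≋-trans (+-cong (e x) (∑-zero xs e)) (+-identityˡ 0P)

∑-+ : (xs : List A) (f g : A → Poly) → ∑[ x ∈ xs ] (f x +P g x) ≋ ∑ xs f +P ∑ xs g
∑-+ []       f g = ≋-sym (+-identityˡ 0P)
∑-+ (x ∷ xs) f g = ≋-trans (+-congˡ (∑-+ xs f g)) (interchange (f x) (g x) (∑ xs f) (∑ xs g))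
  where
  interchange : ∀ a b c d → (a +P b) +P (c +P d) ≋ (a +P c) +P (b +P d)
  interchange = solve-∀ Poly-ring

∑-distribˡ : (xs : List A) (c : Poly) (f : A → Poly) → ∑[ x ∈ xs ] (c *P f x) ≋ c *P ∑ xs f
∑-distribˡ []       c f = ≋-sym (zeroʳ c)
∑-distribˡ (x ∷ xs) c f = ≋-trans (+-congˡ (∑-distribˡ xs c f)) (≋-sym (distribˡ c (f x) (∑ xs f)))

∑-distribʳ : (xs : List A) (c : Poly) (f : A → Poly) → ∑[ x ∈ xs ] (f x *P c) ≋ ∑ xs f *P c
∑-distribʳ xs c f =
  ≋-trans (∑-cong xs (λ x → *-comm (f x) c)) (≋-trans (∑-distribˡ xs c f) (*-comm c (∑ xs f)))

∑-comm : (xs : List A) (ys : List B) (g : A → B → Poly) →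
         ∑[ x ∈ xs ] ∑ ys (g x) ≋ ∑[ y ∈ ys ] ∑[ x ∈ xs ] g x y
∑-comm []       ys g = ≋-sym (∑-zero ys (λ _ → ≋-refl))
∑-comm (x ∷ xs) ys g =
  ≋-trans (+-congˡ (∑-comm xs ys g)) (≋-sym (∑-+ ys (g x) (λ y → ∑[ x ∈ xs ] g x y)))

∑-filter : (xs : List A) (P : A → Bool) (f : A → Poly) → ∑ (filterᵇ P xs) f ≋ ∑[ x ∈ xs ] when (P x) (f x)
∑-filter []       P f = ≋-refl
∑-filter (x ∷ xs) P f with P x
... | true  = +-congˡ (∑-filter xs P f)
... | false = ∑-filter xs P f

when-zero : ∀ b → when b 0P ≋ 0P
when-zero true  = ≋-refl
when-zero false = ≋-refl

when-cong : ∀ b {p r} → p ≋ r → when b p ≋ when b r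
when-cong true  e = e
when-cong false e = ≋-refl

when-*ˡ : ∀ b c p → when b (c *P p) ≋ c *P when b p
when-*ˡ true  c p = ≋-refl
when-*ˡ false c p = ≋-sym (zeroʳ c)

when-*ʳ : ∀ b c p → when b (p *P c) ≋ when b p *P c
when-*ʳ true  c p = ≋-refl
when-*ʳ false c p = ≋-sym (zeroˡ c)

filterᵇ-cong : {P Q : A → Bool} → (∀ x → P x ≡ Q x) → (xs : List A) → filterᵇ P xs ≡ filterᵇ Q xs
filterᵇ-cong {P = P} {Q} e []       = refl
filterᵇ-cong {P = P} {Q} e (x ∷ xs) with P x | Q x | e x
... | true  | true  | _ = cong (x ∷_) (filterᵇ-cong e xs)
... | false | false | _ = filterᵇ-cong e xs

filterᵇ-none : {P : A → Bool} {xs : List A} → All (λ x → P x ≡ false) xs → filterᵇ P xs ≡ []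
filterᵇ-none {P = P} []                 = refl
filterᵇ-none {P = P} {x ∷ _} (e ∷ es) with P x | e
... | false | _ = filterᵇ-none es

filterᵇ-all : (xs : List A) → filterᵇ (λ _ → true) xs ≡ xs
filterᵇ-all []       = refl
filterᵇ-all (x ∷ xs) = cong (x ∷_) (filterᵇ-all xs)

filterᵇ-comm : (P Q : A → Bool) (xs : List A) → filterᵇ P (filterᵇ Q xs) ≡ filterᵇ Q (filterᵇ P xs)
filterᵇ-comm P Q []       = refl
filterᵇ-comm P Q (x ∷ xs) with P x in eP | Q x in eQ
... | true  | true  rewrite eP | eQ = cong (x ∷_) (filterᵇ-comm P Q xs)
... | true  | false rewrite eQ      = filterᵇ-comm P Q xs
... | false | true  rewrite eP      = filterᵇ-comm P Q xs
... | false | false                 = filterᵇ-comm P Q xs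

filterᵇ-++ : (P : A → Bool) (xs ys : List A) → filterᵇ P (xs ++ ys) ≡ filterᵇ P xs ++ filterᵇ P ys
filterᵇ-++ P = List.filter-++ (T? ∘ P)

length-filterᵇ-++ : (P : A → Bool) (xs ys : List A) →
                    length (filterᵇ P (xs ++ ys)) ≡ length (filterᵇ P xs) + length (filterᵇ P ys)
length-filterᵇ-++ P xs ys = trans (cong length (filterᵇ-++ P xs ys)) (List.length-++ (filterᵇ P xs))

filterᵇ-concatMap : (P : B → Bool) (g : A → List B) (xs : List A) →
                    filterᵇ P (concatMap g xs) ≡ concatMap (filterᵇ P ∘ g) xs
filterᵇ-concatMap P g []       = refl
filterᵇ-concatMap P g (x ∷ xs) =
  trans (filterᵇ-++ P (g x) (concatMap g xs)) (cong (filterᵇ P (g x) ++_) (filterᵇ-concatMap P g xs))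

filterᵇ-map : (P : B → Bool) (h : A → B) (xs : List A) → filterᵇ P (map h xs) ≡ map h (filterᵇ (P ∘ h) xs)
filterᵇ-map P h []       = refl
filterᵇ-map P h (x ∷ xs) with P (h x)
... | true  = cong (h x ∷_) (filterᵇ-map P h xs)
... | false = filterᵇ-map P h xs

concatMap-filterᵇ : (P : A → Bool) (g : A → List B) (xs : List A) →
                    concatMap g (filterᵇ P xs) ≡ concatMap (λ x → if P x then g x else []) xs
concatMap-filterᵇ P g []       = refl
concatMap-filterᵇ P g (x ∷ xs) with P x
... | true  = cong (g x ++_) (concatMap-filterᵇ P g xs)
... | false = concatMap-filterᵇ P g xs

-- q-integers

X : Poly
X = qpow 1

∷-congʳ : ∀ {a p r} → p ≋ r → (a ∷ p) ≋ (a ∷ r)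
∷-congʳ {a} {p} {r} (mk e) = mk (∷-cong {a} {a} {p} {r} refl e)

0∷-*P : ∀ p r → (+ 0 ∷ p) *P r ≋ + 0 ∷ (p *P r)
0∷-*P p r = mk λ d → begin
  coeff ((+ 0 ·P r) +P (+ 0 ∷ (p *P r))) d        ≡⟨ coeff-+P (+ 0 ·P r) (+ 0 ∷ (p *P r)) d ⟩
  coeff (+ 0 ·P r) d +ℤ coeff (+ 0 ∷ (p *P r)) d   ≡⟨ cong (_+ℤ coeff (+ 0 ∷ (p *P r)) d) (trans (coeff-·P (+ 0) r d) (ℤ.*-zeroˡ (coeff r d))) ⟩
  + 0 +ℤ coeff (+ 0 ∷ (p *P r)) d                  ≡⟨ ℤ.+-identityˡ _ ⟩
  coeff (+ 0 ∷ (p *P r)) d                         ∎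
  where open ≡-Reasoning

0∷≋X*P : ∀ p → (+ 0 ∷ p) ≋ X *P p
0∷≋X*P p = ≋-sym (≋-trans (0∷-*P (+ 1 ∷ []) p) (∷-congʳ (*-identityˡ p)))

qpow-+ : ∀ a b → qpow (a + b) ≋ qpow a *P qpow b
qpow-+ zero    b = ≋-sym (*-identityˡ (qpow b))
qpow-+ (suc a) b = ≋-trans (∷-congʳ (qpow-+ a b)) (≋-sym (0∷-*P (qpow a) (qpow b)))

qpow-suc : ∀ a → qpow (suc a) ≋ X *P qpow a
qpow-suc a = 0∷≋X*P (qpow a)

qint-suc : ∀ n → qint (suc n) ≋ 1P +P X *P qint n
qint-suc n = ≋-trans (mk λ { zero → refl ; (suc d) → refl }) (+-congˡ {1P} (0∷≋X*P (qint n)))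

qint-+ : ∀ a b → qint (a + b) ≋ qint a +P qpow a *P qint b
qint-+ zero    b = ≋-sym (≋-trans (+-congˡ (*-identityˡ (qint b))) (+-identityˡ (qint b)))
qint-+ (suc a) b = begin
  qint (suc a + b)                               ≈⟨ qint-suc (a + b) ⟩
  1P +P X *P qint (a + b)                        ≈⟨ +-congˡ {1P} (*-congˡ {X} (qint-+ a b)) ⟩
  1P +P X *P (qint a +P qpow a *P qint b)        ≈⟨ regroup (qint a) (qpow a) (qint b) ⟩
  (1P +P X *P qint a) +P (X *P qpow a) *P qint b ≈⟨ +-cong (qint-suc a) (*-congʳ (qpow-suc a)) ⟨
  qint (suc a) +P qpow (suc a) *P qint b         ∎
  where
  open ≋-Reasoning
  regroup : ∀ u v w → 1P +P X *P (u +P v *P w) ≋ (1P +P X *P u) +P (X *P v) *P w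
  regroup = solve-∀ Poly-ring

qint-sucʳ : ∀ n → qint (suc n) ≋ qint n +P qpow n
qint-sucʳ n = ≋-trans (≡⇒≋ (cong qint (ℕ.+-comm 1 n))) (≋-trans (qint-+ n 1) (+-congˡ (*-identityʳ (qpow n))))

-- Shifting and restricting rook placements

shiftRow : Cell → Cell
shiftRow (r , c) = (suc r , c)

columns : List Cell → List ℕ
columns = map proj₂

avoids : ℕ → List Cell → Bool
avoids c p = not (memℕ c (columns p))

placementsFrom-shiftRow : ∀ ls r U → placementsFrom (suc r) U ls ≡ map (map shiftRow) (placementsFrom r U ls)
placementsFrom-shiftRow []       r U = refl
placementsFrom-shiftRow (l ∷ ls) r U = begin
  placementsFrom (suc (suc r)) U ls ++ concatMap (λ c → map ((suc r , c) ∷_) (placementsFrom (suc (suc r)) (c ∷ U) ls)) free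
    ≡⟨ cong₂ _++_ (placementsFrom-shiftRow ls (suc r) U)
                  (List.concatMap-cong (λ c → cong (map ((suc r , c) ∷_)) (placementsFrom-shiftRow ls (suc r) (c ∷ U))) free) ⟩
  map (map shiftRow) (placementsFrom (suc r) U ls) ++ concatMap (λ c → map ((suc r , c) ∷_) (map (map shiftRow) (P c))) free
    ≡⟨ cong (map (map shiftRow) (placementsFrom (suc r) U ls) ++_)
            (List.concatMap-cong (λ c → trans (sym (List.map-∘ (P c))) (List.map-∘ (P c))) free) ⟩
  map (map shiftRow) (placementsFrom (suc r) U ls) ++ concatMap (λ c → map (map shiftRow) (map ((r , c) ∷_) (P c))) free
    ≡⟨ cong (map (map shiftRow) (placementsFrom (suc r) U ls) ++_)
            (sym (List.map-concatMap (map shiftRow) (λ c → map ((r , c) ∷_) (P c)) free)) ⟩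
  map (map shiftRow) (placementsFrom (suc r) U ls) ++ map (map shiftRow) (concatMap (λ c → map ((r , c) ∷_) (P c)) free)
    ≡⟨ sym (List.map-++ (map shiftRow) (placementsFrom (suc r) U ls) _) ⟩
  map (map shiftRow) (placementsFrom r U (l ∷ ls)) ∎
  where
  open ≡-Reasoning
  free = filterᵇ (λ c → not (memℕ c U)) (upTo l)
  P : ℕ → List (List Cell)
  P c = placementsFrom (suc r) (c ∷ U) ls

≡ᵇ-sym : ∀ m n → (m ≡ᵇ n) ≡ (n ≡ᵇ m)
≡ᵇ-sym zero    zero    = refl
≡ᵇ-sym zero    (suc n) = refl
≡ᵇ-sym (suc m) zero    = refl
≡ᵇ-sym (suc m) (suc n) = ≡ᵇ-sym m n

≡ᵇ-true : ∀ m n → (m ≡ᵇ n) ≡ true → m ≡ n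
≡ᵇ-true zero    zero    e = refl
≡ᵇ-true (suc m) (suc n) e = cong suc (≡ᵇ-true m n e)

-- The inductive step needs the order in which two columns are forbidden
-- to be irrelevant, which the induction hypothesis provides.
placementsFrom-forbid : ∀ ls r c U → placementsFrom r (c ∷ U) ls ≡ filterᵇ (avoids c) (placementsFrom r U ls)
placementsFrom-forbid []       r c U = refl
placementsFrom-forbid (l ∷ ls) r c U =
  trans (cong₂ _++_ (placementsFrom-forbid ls (suc r) c U)
          (trans (concatMap-filterᵇ (λ c′ → not (memℕ c′ (c ∷ U))) _ (upTo l))
          (trans (List.concatMap-cong step (upTo l))
                 (sym (concatMap-filterᵇ (λ c′ → not (memℕ c′ U)) _ (upTo l))))))
  (sym (trans (filterᵇ-++ (avoids c) (P U) _)
              (cong (filterᵇ (avoids c) (P U) ++_)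
                    (filterᵇ-concatMap (avoids c) _ (filterᵇ (λ c′ → not (memℕ c′ U)) (upTo l))))))
  where
  P : List ℕ → List (List Cell)
  P V = placementsFrom (suc r) V ls
  forbid-comm : ∀ c′ → P (c′ ∷ c ∷ U) ≡ P (c ∷ c′ ∷ U)
  forbid-comm c′ = begin
    P (c′ ∷ c ∷ U)                                  ≡⟨ placementsFrom-forbid ls (suc r) c′ (c ∷ U) ⟩
    filterᵇ (avoids c′) (P (c ∷ U))                 ≡⟨ cong (filterᵇ (avoids c′)) (placementsFrom-forbid ls (suc r) c U) ⟩
    filterᵇ (avoids c′) (filterᵇ (avoids c) (P U))  ≡⟨ filterᵇ-comm (avoids c′) (avoids c) (P U) ⟩
    filterᵇ (avoids c) (filterᵇ (avoids c′) (P U))  ≡⟨ cong (filterᵇ (avoids c)) (placementsFrom-forbid ls (suc r) c′ U) ⟨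
    filterᵇ (avoids c) (P (c′ ∷ U))                 ≡⟨ placementsFrom-forbid ls (suc r) c (c′ ∷ U) ⟨
    P (c ∷ c′ ∷ U)                                  ∎
    where open ≡-Reasoning
  step : ∀ c′ → (if not (memℕ c′ (c ∷ U)) then map ((r , c′) ∷_) (P (c′ ∷ c ∷ U)) else [])
              ≡ (if not (memℕ c′ U) then filterᵇ (avoids c) (map ((r , c′) ∷_) (P (c′ ∷ U))) else [])
  step c′ with c′ ≡ᵇ c in e | memℕ c′ U
  ... | true  | true  = refl
  ... | false | true  = refl
  ... | true  | false = sym (trans (filterᵇ-map (avoids c) ((r , c′) ∷_) (P (c′ ∷ U)))
                          (cong (map ((r , c′) ∷_)) (filterᵇ-none {xs = P (c′ ∷ U)} (All.tabulate λ {x} _ → cong (λ b → not (b ∨ memℕ c (columns x))) (trans (≡ᵇ-sym c c′) e)))))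
  ... | false | false = sym (trans (filterᵇ-map (avoids c) ((r , c′) ∷_) (P (c′ ∷ U)))
                          (cong (map ((r , c′) ∷_))
                            (trans (filterᵇ-cong (λ x → cong (λ b → not (b ∨ memℕ c (columns x))) (trans (≡ᵇ-sym c c′) e)) (P (c′ ∷ U)))
                            (trans (sym (placementsFrom-forbid ls (suc r) c (c′ ∷ U))) (sym (forbid-comm c′))))))

cellsFrom-shiftRow : ∀ ls r → cellsFrom (suc r) ls ≡ map shiftRow (cellsFrom r ls)
cellsFrom-shiftRow []       r = refl
cellsFrom-shiftRow (l ∷ ls) r =
  trans (cong₂ _++_ (List.map-∘ (upTo l)) (cellsFrom-shiftRow ls (suc r)))
        (sym (List.map-++ shiftRow (map (r ,_) (upTo l)) (cellsFrom (suc r) ls)))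

counted-shiftRow : ∀ p r c → counted (map shiftRow p) (suc r , c) ≡ counted p (r , c)
counted-shiftRow []              r c = refl
counted-shiftRow ((r′ , c′) ∷ p) r c =
  cong (λ b → not ((((r ≡ᵇ r′) ∧ (c ≡ᵇ c′)) ∨ ((r ≡ᵇ r′) ∧ (c <ᵇ c′)) ∨ ((c ≡ᵇ c′) ∧ (r <ᵇ r′))) ∨ b))
       (Bool.not-injective (counted-shiftRow p r c))

count : (A → Bool) → List A → ℕ
count P xs = length (filterᵇ P xs)

count-cong : {P Q : A → Bool} → (∀ x → P x ≡ Q x) → ∀ xs → count P xs ≡ count Q xs
count-cong e xs = cong length (filterᵇ-cong e xs)

count-map : (P : B → Bool) (h : A → B) (xs : List A) → count P (map h xs) ≡ count (P ∘ h) xs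
count-map P h xs = trans (cong length (filterᵇ-map P h xs)) (List.length-map h (filterᵇ (P ∘ h) xs))

invFrom : ℕ → List ℕ → List Cell → ℕ
invFrom r ls p = count (counted p) (cellsFrom r ls)

invFrom-shiftRow : ∀ ls r p → invFrom (suc r) ls (map shiftRow p) ≡ invFrom r ls p
invFrom-shiftRow ls r p = begin
  count (counted (map shiftRow p)) (cellsFrom (suc r) ls)       ≡⟨ cong (count (counted (map shiftRow p))) (cellsFrom-shiftRow ls r) ⟩
  count (counted (map shiftRow p)) (map shiftRow (cellsFrom r ls)) ≡⟨ count-map (counted (map shiftRow p)) shiftRow (cellsFrom r ls) ⟩
  count (counted (map shiftRow p) ∘ shiftRow) (cellsFrom r ls)  ≡⟨ count-cong (λ (r′ , c′) → counted-shiftRow p r′ c′) (cellsFrom r ls) ⟩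
  count (counted p) (cellsFrom r ls)                           ∎
  where open ≡-Reasoning

∨-congʳ : ∀ {a b x} → a ≡ b → (a ∨ x) ≡ (b ∨ x)
∨-congʳ refl = refl

counted-firstRow-noRook : ∀ p c → counted (map shiftRow p) (0 , c) ≡ avoids c p
counted-firstRow-noRook []              c = refl
counted-firstRow-noRook ((r′ , c′) ∷ p) c =
  cong not (trans (∨-congʳ (Bool.∧-identityʳ (c ≡ᵇ c′)))
                  (cong ((c ≡ᵇ c′) ∨_) (Bool.not-injective (counted-firstRow-noRook p c))))

counted-belowRook : ∀ p c r c′ → counted ((0 , c) ∷ map shiftRow p) (suc r , c′) ≡ counted p (r , c′)
counted-belowRook p c r c′ = trans (cong not (∨-congʳ (Bool.∧-zeroʳ (c′ ≡ᵇ c)))) (counted-shiftRow p r c′)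

not-≤ᵇ : ∀ x c → not ((x ≡ᵇ c) ∨ (x <ᵇ c) ∨ false) ≡ (c <ᵇ x)
not-≤ᵇ zero    zero    = refl
not-≤ᵇ zero    (suc c) = refl
not-≤ᵇ (suc x) zero    = refl
not-≤ᵇ (suc x) (suc c) = not-≤ᵇ x c

not-∨ : ∀ a b → not (a ∨ b) ≡ not a ∧ not b
not-∨ true  b = refl
not-∨ false b = refl

counted-firstRow-rook : ∀ p c c′ → counted ((0 , c) ∷ map shiftRow p) (0 , c′) ≡ (c <ᵇ c′) ∧ avoids c′ p
counted-firstRow-rook p c c′ =
  trans (cong not (∨-congʳ (cong ((c′ ≡ᵇ c) ∨_) (cong ((c′ <ᵇ c) ∨_) (Bool.∧-zeroʳ (c′ ≡ᵇ c))))))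
        (trans (not-∨ ((c′ ≡ᵇ c) ∨ (c′ <ᵇ c) ∨ false) _) (cong₂ _∧_ (not-≤ᵇ c′ c) (counted-firstRow-noRook p c′)))

inv-cons : ∀ a ls p → inv (a ∷ ls) p ≡ count (λ c → counted p (0 , c)) (upTo a) + invFrom 1 ls p
inv-cons a ls p =
  trans (length-filterᵇ-++ (counted p) (map (0 ,_) (upTo a)) (cellsFrom 1 ls))
        (cong (_+ invFrom 1 ls p) (count-map (counted p) (0 ,_) (upTo a)))

inv-noRookInFirstRow : ∀ a ls p → inv (a ∷ ls) (map shiftRow p) ≡ count (λ c → avoids c p) (upTo a) + inv ls p
inv-noRookInFirstRow a ls p =
  trans (inv-cons a ls (map shiftRow p))
        (cong₂ _+_ (count-cong (counted-firstRow-noRook p) (upTo a)) (invFrom-shiftRow ls 0 p))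

inv-rookInFirstRow : ∀ a ls c p →
  inv (a ∷ ls) ((0 , c) ∷ map shiftRow p) ≡ count (λ c′ → (c <ᵇ c′) ∧ avoids c′ p) (upTo a) + inv ls p
inv-rookInFirstRow a ls c p =
  trans (inv-cons a ls ((0 , c) ∷ map shiftRow p))
        (cong₂ _+_ (count-cong (counted-firstRow-rook p c) (upTo a)) belowFirstRow)
  where
  open ≡-Reasoning
  q = (0 , c) ∷ map shiftRow p
  belowFirstRow : invFrom 1 ls q ≡ inv ls p
  belowFirstRow = begin
    count (counted q) (cellsFrom 1 ls)                 ≡⟨ cong (count (counted q)) (cellsFrom-shiftRow ls 0) ⟩
    count (counted q) (map shiftRow (cellsFrom 0 ls))  ≡⟨ count-map (counted q) shiftRow (cellsFrom 0 ls) ⟩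
    count (counted q ∘ shiftRow) (cellsFrom 0 ls)      ≡⟨ count-cong (λ (r′ , c′) → counted-belowRook p c r′ c′) (cellsFrom 0 ls) ⟩
    count (counted p) (cellsFrom 0 ls)                 ∎

-- Counting free columns

Admissible : ℕ → List ℕ → List Cell → Set
Admissible a U []            = ⊤
Admissible a U ((r , c) ∷ p) = (memℕ c U ≡ false) × (c < a) × Admissible a (c ∷ U) p

All-filterᵇ : {Q : A → Set} (P : A → Bool) (xs : List A) → All Q xs → All (λ x → (P x ≡ true) × Q x) (filterᵇ P xs)
All-filterᵇ P []       []       = []
All-filterᵇ P (x ∷ xs) (q ∷ qs) with P x in e
... | true  = (e , q) ∷ All-filterᵇ P xs qs
... | false = All-filterᵇ P xs qs

All-upTo : ∀ n → All (_< n) (upTo n)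
All-upTo n = All.applyUpTo⁺₁ id n id

not-true : ∀ {b} → not b ≡ true → b ≡ false
not-true {false} _ = refl

placementsFrom-admissible : ∀ a ls r U → All (_≤ a) ls → All (Admissible a U) (placementsFrom r U ls)
placementsFrom-admissible a []       r U h          = tt ∷ []
placementsFrom-admissible a (l ∷ ls) r U (l≤a ∷ h) =
  All.++⁺ (placementsFrom-admissible a ls (suc r) U h)
    (All.concat⁺ (All.map⁺
      (All.map (λ { {c} (e , c<l) → All.map⁺ (All.map (λ adm → not-true e , ℕ.<-≤-trans c<l l≤a , adm)
                                                        (placementsFrom-admissible a ls (suc r) (c ∷ U) h)) })
               (All-filterᵇ (λ c → not (memℕ c U)) (upTo l) (All-upTo l)))))

count-split : ∀ (P Q : A → Bool) xs → count (λ x → P x ∧ not (Q x)) xs + count (λ x → P x ∧ Q x) xs ≡ count P xs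
count-split P Q []       = refl
count-split P Q (x ∷ xs) with P x | Q x
... | true  | true  = trans (ℕ.+-suc _ _) (cong suc (count-split P Q xs))
... | true  | false = cong suc (count-split P Q xs)
... | false | _     = count-split P Q xs

upTo-suc : ∀ n → upTo (suc n) ≡ 0 ∷ map suc (upTo n)
upTo-suc n = cong (0 ∷_) (sym (List.map-applyUpTo id suc n))

count-≡ᵇ-upTo : ∀ a c → c < a → count (_≡ᵇ c) (upTo a) ≡ 1
count-≡ᵇ-upTo (suc a) zero    _ = begin
  count (_≡ᵇ 0) (upTo (suc a))           ≡⟨ cong (count (_≡ᵇ 0)) (upTo-suc a) ⟩
  suc (count (_≡ᵇ 0) (map suc (upTo a))) ≡⟨ cong suc (count-map (_≡ᵇ 0) suc (upTo a)) ⟩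
  suc (count (λ _ → false) (upTo a))     ≡⟨ cong (suc ∘ length) (filterᵇ-none {xs = upTo a} (All.tabulate λ _ → refl)) ⟩
  1                                      ∎
  where open ≡-Reasoning
count-≡ᵇ-upTo (suc a) (suc c) (s≤s c<a) = begin
  count (_≡ᵇ suc c) (upTo (suc a))       ≡⟨ cong (count (_≡ᵇ suc c)) (upTo-suc a) ⟩
  count (_≡ᵇ suc c) (map suc (upTo a))   ≡⟨ count-map (_≡ᵇ suc c) suc (upTo a) ⟩
  count (_≡ᵇ c) (upTo a)                 ≡⟨ count-≡ᵇ-upTo a c c<a ⟩
  1                                      ∎
  where open ≡-Reasoning

not-memℕ-∷ : ∀ x c U → not (memℕ x (c ∷ U)) ≡ not (memℕ x U) ∧ not (x ≡ᵇ c)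
not-memℕ-∷ x c U with x ≡ᵇ c | memℕ x U
... | true  | true  = refl
... | true  | false = refl
... | false | m     = sym (Bool.∧-identityʳ (not m))

avoids-∷ : ∀ x r c U p → not (memℕ x U) ∧ avoids x ((r , c) ∷ p) ≡ not (memℕ x (c ∷ U)) ∧ avoids x p
avoids-∷ x r c U p with x ≡ᵇ c | memℕ x U
... | true  | true  = refl
... | true  | false = refl
... | false | _     = refl

count-free-columns : ∀ a U p → Admissible a U p →
  count (λ x → not (memℕ x U) ∧ avoids x p) (upTo a) + length p ≡ count (λ x → not (memℕ x U)) (upTo a)
count-free-columns a U []            _ = trans (ℕ.+-identityʳ _) (count-cong (λ x → Bool.∧-identityʳ _) (upTo a))
count-free-columns a U ((r , c) ∷ p) (c∉U , c<a , adm) = begin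
  count (λ x → not (memℕ x U) ∧ avoids x ((r , c) ∷ p)) (upTo a) + suc (length p)
    ≡⟨ ℕ.+-suc _ _ ⟩
  suc (count (λ x → not (memℕ x U) ∧ avoids x ((r , c) ∷ p)) (upTo a) + length p)
    ≡⟨ cong (λ k → suc (k + length p)) (count-cong (λ x → avoids-∷ x r c U p) (upTo a)) ⟩
  suc (count (λ x → not (memℕ x (c ∷ U)) ∧ avoids x p) (upTo a) + length p)
    ≡⟨ cong suc (count-free-columns a (c ∷ U) p adm) ⟩
  suc (count (λ x → not (memℕ x (c ∷ U))) (upTo a))
    ≡⟨ ℕ.+-comm 1 _ ⟩
  count (λ x → not (memℕ x (c ∷ U))) (upTo a) + 1
    ≡⟨ cong₂ _+_ (count-cong (λ x → not-memℕ-∷ x c U) (upTo a))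
                 (sym (trans (count-cong only-c (upTo a)) (count-≡ᵇ-upTo a c c<a))) ⟩
  count (λ x → not (memℕ x U) ∧ not (x ≡ᵇ c)) (upTo a) + count (λ x → not (memℕ x U) ∧ (x ≡ᵇ c)) (upTo a)
    ≡⟨ count-split (λ x → not (memℕ x U)) (_≡ᵇ c) (upTo a) ⟩
  count (λ x → not (memℕ x U)) (upTo a) ∎
  where
  open ≡-Reasoning
  only-c : ∀ x → not (memℕ x U) ∧ (x ≡ᵇ c) ≡ (x ≡ᵇ c)
  only-c x with x ≡ᵇ c in e
  ... | true rewrite ≡ᵇ-true x c e | c∉U = refl
  ... | false = Bool.∧-zeroʳ _

count-avoids : ∀ a p → Admissible a [] p → count (λ x → avoids x p) (upTo a) ≡ a ∸ length p
count-avoids a p adm = begin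
  count (λ x → avoids x p) (upTo a)                     ≡⟨ ℕ.m+n∸n≡m _ (length p) ⟨
  count (λ x → avoids x p) (upTo a) + length p ∸ length p ≡⟨ cong (_∸ length p) (count-free-columns a [] p adm) ⟩
  count (λ _ → true) (upTo a) ∸ length p                ≡⟨ cong (λ xs → length xs ∸ length p) (filterᵇ-all (upTo a)) ⟩
  length (upTo a) ∸ length p                            ≡⟨ cong (_∸ length p) (List.length-upTo a) ⟩
  a ∸ length p                                          ∎
  where open ≡-Reasoning

ind : Bool → ℕ
ind true  = 1
ind false = 0

count-[] : (P : A → Bool) (x : A) → count P (x ∷ []) ≡ ind (P x)
count-[] P x with P x
... | true  = refl
... | false = refl

count-upTo-suc : (P : ℕ → Bool) (a : ℕ) → count P (upTo (suc a)) ≡ count P (upTo a) + ind (P a)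
count-upTo-suc P a =
  trans (cong (count P) (sym (List.upTo-∷ʳ a)))
        (trans (length-filterᵇ-++ P (upTo a) (a ∷ [])) (cong (λ k → count P (upTo a) + k) (count-[] P a)))

<ᵇ-true : ∀ m n → m < n → (m <ᵇ n) ≡ true
<ᵇ-true zero    (suc n) _         = refl
<ᵇ-true (suc m) (suc n) (s≤s m<n) = <ᵇ-true m n m<n

<ᵇ-false : ∀ m n → n ≤ m → (m <ᵇ n) ≡ false
<ᵇ-false m       zero    _         = refl
<ᵇ-false (suc m) (suc n) (s≤s n≤m) = <ᵇ-false m n n≤m

qint-+-ind : ∀ b n → qpow (ind b) *P qint n +P when b 1P ≋ qint (n + ind b)
qint-+-ind true  n = ≋-trans (+-comm (qpow 1 *P qint n) 1P) (≋-trans (≋-sym (qint-suc n)) (≡⇒≋ (cong qint (ℕ.+-comm 1 n))))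
qint-+-ind false n = ≋-trans (+-identityʳ (qpow 0 *P qint n)) (≋-trans (*-identityˡ (qint n)) (≡⇒≋ (cong qint (sym (ℕ.+-identityʳ n)))))

module FreeColumns (U : List ℕ) where

  free : ℕ → Bool
  free c = not (memℕ c U)

  freeRightOf : ℕ → ℕ → ℕ
  freeRightOf a c = count (λ x → (c <ᵇ x) ∧ free x) (upTo a)

  freeRightOf-suc : ∀ a c → c < a → freeRightOf (suc a) c ≡ freeRightOf a c + ind (free a)
  freeRightOf-suc a c c<a =
    trans (count-upTo-suc (λ x → (c <ᵇ x) ∧ free x) a) (cong (λ b → freeRightOf a c + ind (b ∧ free a)) (<ᵇ-true c a c<a))

  freeRightOf-last : ∀ a → freeRightOf (suc a) a ≡ 0
  freeRightOf-last a =
    cong length (filterᵇ-none (All.map (λ {x} x<sa → cong (_∧ free x) (<ᵇ-false a x (ℕ.≤-pred x<sa))) (All-upTo (suc a))))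

  ∑-qpow-freeRightOf : ∀ a → ∑[ c ∈ upTo a ] when (free c) (qpow (freeRightOf a c)) ≋ qint (count free (upTo a))
  ∑-qpow-freeRightOf zero    = ≋-refl
  ∑-qpow-freeRightOf (suc a) = begin
    ∑[ c ∈ upTo (suc a) ] when (free c) (qpow (freeRightOf (suc a) c))
      ≡⟨ cong (λ xs → ∑[ c ∈ xs ] when (free c) (qpow (freeRightOf (suc a) c))) (List.upTo-∷ʳ a) ⟨
    ∑[ c ∈ upTo a ++ a ∷ [] ] when (free c) (qpow (freeRightOf (suc a) c))
      ≈⟨ ∑-++ (upTo a) (a ∷ []) _ ⟩
    ∑[ c ∈ upTo a ] when (free c) (qpow (freeRightOf (suc a) c)) +P (when (free a) (qpow (freeRightOf (suc a) a)) +P 0P)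
      ≈⟨ +-cong (∑-cong-All (All.map (λ {c} c<a → earlier c c<a) (All-upTo a)))
                (≋-trans (+-identityʳ _) (when-cong (free a) (≡⇒≋ (cong qpow (freeRightOf-last a))))) ⟩
    ∑[ c ∈ upTo a ] (qpow (ind (free a)) *P when (free c) (qpow (freeRightOf a c))) +P when (free a) 1P
      ≈⟨ +-congʳ {when (free a) 1P} (∑-distribˡ (upTo a) (qpow (ind (free a))) _) ⟩
    qpow (ind (free a)) *P ∑[ c ∈ upTo a ] when (free c) (qpow (freeRightOf a c)) +P when (free a) 1P
      ≈⟨ +-congʳ {when (free a) 1P} (*-congˡ {qpow (ind (free a))} (∑-qpow-freeRightOf a)) ⟩
    qpow (ind (free a)) *P qint (count free (upTo a)) +P when (free a) 1P
      ≈⟨ qint-+-ind (free a) (count free (upTo a)) ⟩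
    qint (count free (upTo a) + ind (free a))
      ≡⟨ cong qint (count-upTo-suc free a) ⟨
    qint (count free (upTo (suc a))) ∎
    where
    open ≋-Reasoning
    earlier : ∀ c → c < a → when (free c) (qpow (freeRightOf (suc a) c)) ≋ qpow (ind (free a)) *P when (free c) (qpow (freeRightOf a c))
    earlier c c<a = begin
      when (free c) (qpow (freeRightOf (suc a) c))                 ≡⟨ cong (when (free c) ∘ qpow) (freeRightOf-suc a c c<a) ⟩
      when (free c) (qpow (freeRightOf a c + ind (free a)))        ≈⟨ when-cong (free c) (qpow-+ (freeRightOf a c) (ind (free a))) ⟩
      when (free c) (qpow (freeRightOf a c) *P qpow (ind (free a))) ≈⟨ when-*ʳ (free c) _ _ ⟩
      when (free c) (qpow (freeRightOf a c)) *P qpow (ind (free a)) ≈⟨ *-comm (when (free c) (qpow (freeRightOf a c))) (qpow (ind (free a))) ⟩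
      qpow (ind (free a)) *P when (free c) (qpow (freeRightOf a c)) ∎

-- Removing the first row of a board

hasSize : ℕ → List Cell → Bool
hasSize k p = length p ≡ᵇ k

rook : ℕ → List ℕ → Poly
rook k ls = ∑ (filterᵇ (hasSize k) (placements ls)) (λ p → qpow (inv ls p))

hasSize-shiftRow : ∀ k p → hasSize k (map shiftRow p) ≡ hasSize k p
hasSize-shiftRow k p = cong (_≡ᵇ k) (List.length-map shiftRow p)

∑-filterᵇ-map : (P : B → Bool) (h : A → B) (xs : List A) (f : B → Poly) →
                ∑ (filterᵇ P (map h xs)) f ≋ ∑[ x ∈ xs ] when (P (h x)) (f (h x))
∑-filterᵇ-map P h xs f = begin
  ∑ (filterᵇ P (map h xs)) f            ≡⟨ cong (λ ys → ∑ ys f) (filterᵇ-map P h xs) ⟩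
  ∑ (map h (filterᵇ (P ∘ h) xs)) f      ≡⟨ ∑-map (filterᵇ (P ∘ h) xs) h f ⟩
  ∑ (filterᵇ (P ∘ h) xs) (f ∘ h)        ≈⟨ ∑-filter xs (P ∘ h) (f ∘ h) ⟩
  ∑[ x ∈ xs ] when (P (h x)) (f (h x))  ∎
  where open ≋-Reasoning

∑-noRookInFirstRow : ∀ a ls k → All (_≤ a) ls →
  ∑ (filterᵇ (hasSize k) (placementsFrom 1 [] ls)) (λ p → qpow (inv (a ∷ ls) p)) ≋ qpow (a ∸ k) *P rook k ls
∑-noRookInFirstRow a ls k h = begin
  ∑ (filterᵇ (hasSize k) (placementsFrom 1 [] ls)) w
    ≡⟨ cong (λ ps → ∑ (filterᵇ (hasSize k) ps) w) (placementsFrom-shiftRow ls 0 []) ⟩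
  ∑ (filterᵇ (hasSize k) (map (map shiftRow) (placements ls))) w
    ≈⟨ ∑-filterᵇ-map (hasSize k) (map shiftRow) (placements ls) w ⟩
  ∑[ p ∈ placements ls ] when (hasSize k (map shiftRow p)) (w (map shiftRow p))
    ≈⟨ ∑-cong-All (All.map term (placementsFrom-admissible a ls 0 [] h)) ⟩
  ∑[ p ∈ placements ls ] (qpow (a ∸ k) *P when (hasSize k p) (qpow (inv ls p)))
    ≈⟨ ∑-distribˡ (placements ls) (qpow (a ∸ k)) _ ⟩
  qpow (a ∸ k) *P ∑[ p ∈ placements ls ] when (hasSize k p) (qpow (inv ls p))
    ≈⟨ *-congˡ {qpow (a ∸ k)} (∑-filter (placements ls) (hasSize k) _) ⟨
  qpow (a ∸ k) *P rook k ls ∎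
  where
  open ≋-Reasoning
  w : List Cell → Poly
  w p = qpow (inv (a ∷ ls) p)
  term : ∀ {p} → Admissible a [] p →
         when (hasSize k (map shiftRow p)) (w (map shiftRow p)) ≋ qpow (a ∸ k) *P when (hasSize k p) (qpow (inv ls p))
  term {p} adm rewrite hasSize-shiftRow k p with hasSize k p in e
  ... | true  = ≋-trans (≡⇒≋ (cong qpow (trans (inv-noRookInFirstRow a ls p) (cong (_+ inv ls p) free-columns))))
                        (qpow-+ (a ∸ k) (inv ls p))
    where
    free-columns : count (λ c → avoids c p) (upTo a) ≡ a ∸ k
    free-columns = trans (count-avoids a p adm) (cong (a ∸_) (≡ᵇ-true (length p) k e))
  ... | false = ≋-sym (zeroʳ (qpow (a ∸ k)))

rookAt : List ℕ → ℕ → List (List Cell)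
rookAt ls c = map ((0 , c) ∷_) (placementsFrom 1 (c ∷ []) ls)

∑-rookAt : ∀ a ls k c →
  ∑ (filterᵇ (hasSize (suc k)) (rookAt ls c)) (λ p → qpow (inv (a ∷ ls) p))
  ≋ ∑[ p ∈ placements ls ] when (avoids c p) (when (hasSize k p) (qpow (count (λ x → (c <ᵇ x) ∧ avoids x p) (upTo a) + inv ls p)))
∑-rookAt a ls k c = begin
  ∑ (filterᵇ (hasSize (suc k)) (map ((0 , c) ∷_) (placementsFrom 1 (c ∷ []) ls))) w
    ≈⟨ ∑-filterᵇ-map (hasSize (suc k)) ((0 , c) ∷_) (placementsFrom 1 (c ∷ []) ls) w ⟩
  ∑[ p ∈ placementsFrom 1 (c ∷ []) ls ] when (hasSize k p) (w ((0 , c) ∷ p))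
    ≡⟨ cong (λ ps → ∑[ p ∈ ps ] when (hasSize k p) (w ((0 , c) ∷ p)))
            (trans (placementsFrom-shiftRow ls 0 (c ∷ [])) (cong (map (map shiftRow)) (placementsFrom-forbid ls 0 c []))) ⟩
  ∑[ p ∈ map (map shiftRow) (filterᵇ (avoids c) (placements ls)) ] when (hasSize k p) (w ((0 , c) ∷ p))
    ≡⟨ ∑-map (filterᵇ (avoids c) (placements ls)) (map shiftRow) _ ⟩
  ∑[ p ∈ filterᵇ (avoids c) (placements ls) ] when (hasSize k (map shiftRow p)) (w ((0 , c) ∷ map shiftRow p))
    ≈⟨ ∑-filter (placements ls) (avoids c) _ ⟩
  ∑[ p ∈ placements ls ] when (avoids c p) (when (hasSize k (map shiftRow p)) (w ((0 , c) ∷ map shiftRow p)))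
    ≈⟨ ∑-cong (placements ls) (λ p → ≡⇒≋ (cong₂ (λ b n → when (avoids c p) (when b (qpow n)))
                                               (hasSize-shiftRow k p) (inv-rookInFirstRow a ls c p))) ⟩
  ∑[ p ∈ placements ls ] when (avoids c p) (when (hasSize k p) (qpow (count (λ x → (c <ᵇ x) ∧ avoids x p) (upTo a) + inv ls p))) ∎
  where
  open ≋-Reasoning
  w : List Cell → Poly
  w p = qpow (inv (a ∷ ls) p)

∑-firstRowColumns : ∀ a ls k p → Admissible a [] p →
  ∑[ c ∈ upTo a ] when (avoids c p) (when (hasSize k p) (qpow (count (λ x → (c <ᵇ x) ∧ avoids x p) (upTo a) + inv ls p)))
  ≋ when (hasSize k p) (qint (a ∸ k) *P qpow (inv ls p))
∑-firstRowColumns a ls k p adm with hasSize k p in e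
... | false = ∑-zero (upTo a) (λ c → when-zero (avoids c p))
... | true  = begin
  ∑[ c ∈ upTo a ] when (avoids c p) (qpow (freeRightOf a c + inv ls p))
    ≈⟨ ∑-cong (upTo a) (λ c → ≋-trans (when-cong (avoids c p) (qpow-+ (freeRightOf a c) (inv ls p)))
                                      (when-*ʳ (avoids c p) (qpow (inv ls p)) _)) ⟩
  ∑[ c ∈ upTo a ] (when (free c) (qpow (freeRightOf a c)) *P qpow (inv ls p))
    ≈⟨ ∑-distribʳ (upTo a) (qpow (inv ls p)) _ ⟩
  ∑[ c ∈ upTo a ] when (free c) (qpow (freeRightOf a c)) *P qpow (inv ls p)
    ≈⟨ *-congʳ {qpow (inv ls p)} (∑-qpow-freeRightOf a) ⟩
  qint (count free (upTo a)) *P qpow (inv ls p)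
    ≡⟨ cong (λ n → qint n *P qpow (inv ls p)) (trans (count-avoids a p adm) (cong (a ∸_) (≡ᵇ-true (length p) k e))) ⟩
  qint (a ∸ k) *P qpow (inv ls p) ∎
  where
  open ≋-Reasoning
  open FreeColumns (columns p)

firstRowOccupied : ℕ → List ℕ → ℕ → Poly
firstRowOccupied a ls zero    = 0P
firstRowOccupied a ls (suc k) = qint (a ∸ k) *P rook k ls

∑-rookInFirstRow : ∀ a ls k → All (_≤ a) ls →
  ∑[ c ∈ upTo a ] ∑ (filterᵇ (hasSize k) (rookAt ls c)) (λ p → qpow (inv (a ∷ ls) p)) ≋ firstRowOccupied a ls k
∑-rookInFirstRow a ls zero    h = ∑-zero (upTo a) (λ c → ≡⇒≋ (cong (λ ps → ∑ ps (λ p → qpow (inv (a ∷ ls) p)))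
                                    (trans (filterᵇ-map (hasSize 0) ((0 , c) ∷_) (placementsFrom 1 (c ∷ []) ls))
                                           (cong (map ((0 , c) ∷_)) (filterᵇ-none {xs = placementsFrom 1 (c ∷ []) ls} (All.tabulate λ _ → refl))))))
∑-rookInFirstRow a ls (suc k) h = begin
  ∑[ c ∈ upTo a ] ∑ (filterᵇ (hasSize (suc k)) (rookAt ls c)) (λ p → qpow (inv (a ∷ ls) p))
    ≈⟨ ∑-cong (upTo a) (∑-rookAt a ls k) ⟩
  ∑[ c ∈ upTo a ] ∑[ p ∈ placements ls ] term c p
    ≈⟨ ∑-comm (upTo a) (placements ls) term ⟩
  ∑[ p ∈ placements ls ] ∑[ c ∈ upTo a ] term c p
    ≈⟨ ∑-cong-All (All.map (λ {p} → ∑-firstRowColumns a ls k p) (placementsFrom-admissible a ls 0 [] h)) ⟩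
  ∑[ p ∈ placements ls ] when (hasSize k p) (qint (a ∸ k) *P qpow (inv ls p))
    ≈⟨ ∑-cong (placements ls) (λ p → when-*ˡ (hasSize k p) (qint (a ∸ k)) (qpow (inv ls p))) ⟩
  ∑[ p ∈ placements ls ] (qint (a ∸ k) *P when (hasSize k p) (qpow (inv ls p)))
    ≈⟨ ∑-distribˡ (placements ls) (qint (a ∸ k)) _ ⟩
  qint (a ∸ k) *P ∑[ p ∈ placements ls ] when (hasSize k p) (qpow (inv ls p))
    ≈⟨ *-congˡ {qint (a ∸ k)} (∑-filter (placements ls) (hasSize k) _) ⟨
  qint (a ∸ k) *P rook k ls ∎
  where
  open ≋-Reasoning
  term : ℕ → List Cell → Poly
  term c p = when (avoids c p) (when (hasSize k p) (qpow (count (λ x → (c <ᵇ x) ∧ avoids x p) (upTo a) + inv ls p)))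

rook-cons : ∀ a ls k → All (_≤ a) ls → rook k (a ∷ ls) ≋ qpow (a ∸ k) *P rook k ls +P firstRowOccupied a ls k
rook-cons a ls k h = begin
  rook k (a ∷ ls)
    ≡⟨ cong (λ ps → ∑ ps w) (filterᵇ-++ (hasSize k) (placementsFrom 1 [] ls) _) ⟩
  ∑ (filterᵇ (hasSize k) (placementsFrom 1 [] ls) ++ filterᵇ (hasSize k) (concatMap (rookAt ls) free)) w
    ≈⟨ ∑-++ (filterᵇ (hasSize k) (placementsFrom 1 [] ls)) _ w ⟩
  ∑ (filterᵇ (hasSize k) (placementsFrom 1 [] ls)) w +P ∑ (filterᵇ (hasSize k) (concatMap (rookAt ls) free)) w
    ≡⟨ cong (λ ps → ∑ (filterᵇ (hasSize k) (placementsFrom 1 [] ls)) w +P ∑ ps w)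
            (trans (cong (filterᵇ (hasSize k) ∘ concatMap (rookAt ls)) (filterᵇ-all (upTo a)))
                   (filterᵇ-concatMap (hasSize k) (rookAt ls) (upTo a))) ⟩
  ∑ (filterᵇ (hasSize k) (placementsFrom 1 [] ls)) w +P ∑ (concatMap (filterᵇ (hasSize k) ∘ rookAt ls) (upTo a)) w
    ≈⟨ +-cong (∑-noRookInFirstRow a ls k h)
              (≋-trans (∑-concatMap (upTo a) (filterᵇ (hasSize k) ∘ rookAt ls) w) (∑-rookInFirstRow a ls k h)) ⟩
  qpow (a ∸ k) *P rook k ls +P firstRowOccupied a ls k ∎
  where
  open ≋-Reasoning
  free = filterᵇ (λ c → not (memℕ c [])) (upTo a)
  w : List Cell → Poly
  w p = qpow (inv (a ∷ ls) p)

rook-vanish-length : ∀ ls j → AllPairs _≥_ ls → length ls < j → rook j ls ≋ 0P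
rook-vanish-length []       (suc j) _       _         = ≋-refl
rook-vanish-length (b ∷ μ) (suc j) (h ∷ d) (s≤s μ<j) = begin
  rook (suc j) (b ∷ μ)                                                 ≈⟨ rook-cons b μ (suc j) h ⟩
  qpow (b ∸ suc j) *P rook (suc j) μ +P qint (b ∸ j) *P rook j μ       ≈⟨ +-cong (*-congˡ {qpow (b ∸ suc j)} (rook-vanish-length μ (suc j) d (ℕ.m≤n⇒m≤1+n μ<j)))
                                                                                  (*-congˡ {qint (b ∸ j)} (rook-vanish-length μ j d μ<j)) ⟩
  qpow (b ∸ suc j) *P 0P +P qint (b ∸ j) *P 0P                         ≈⟨ +-cong (zeroʳ (qpow (b ∸ suc j))) (zeroʳ (qint (b ∸ j))) ⟩
  0P                                                                   ∎
  where open ≋-Reasoning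

rook-vanish-width : ∀ ls j → AllPairs _≥_ ls → All (_≤ j) ls → rook (suc j) ls ≋ 0P
rook-vanish-width []       j _       _           = ≋-refl
rook-vanish-width (b ∷ μ) j (h ∷ d) (b≤j ∷ μ≤j) = begin
  rook (suc j) (b ∷ μ)                                             ≈⟨ rook-cons b μ (suc j) h ⟩
  qpow (b ∸ suc j) *P rook (suc j) μ +P qint (b ∸ j) *P rook j μ   ≈⟨ +-cong (*-congˡ {qpow (b ∸ suc j)} (rook-vanish-width μ j d μ≤j))
                                                                              (≡⇒≋ (cong (λ n → qint n *P rook j μ) (ℕ.m≤n⇒m∸n≡0 b≤j))) ⟩
  qpow (b ∸ suc j) *P 0P +P 0P                                     ≈⟨ ≋-trans (+-identityʳ _) (zeroʳ (qpow (b ∸ suc j))) ⟩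
  0P                                                               ∎
  where open ≋-Reasoning

-- Removing one row at a time

removals : List A → List (A × List A)
removals []       = []
removals (a ∷ ls) = (a , ls) ∷ map (λ bμ → proj₁ bμ , a ∷ proj₂ bμ) (removals ls)

removals-All : {Q : A → Set} → ∀ ls → All Q ls → All (λ bμ → All Q (proj₂ bμ)) (removals ls)
removals-All []       []       = []
removals-All (a ∷ ls) (qa ∷ qs) = qs ∷ All.map⁺ (All.map (qa ∷_) (removals-All ls qs))

qSum : List A → (A → Poly) → Poly
qSum []       f = 0P
qSum (x ∷ xs) f = f x +P X *P qSum xs f

qSum-map : (xs : List A) (h : A → B) (f : B → Poly) → qSum (map h xs) f ≡ qSum xs (f ∘ h)
qSum-map []       h f = refl
qSum-map (x ∷ xs) h f = cong (λ s → f (h x) +P X *P s) (qSum-map xs h f)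

qSum-cong-All : {xs : List A} {f g : A → Poly} → All (λ x → f x ≋ g x) xs → qSum xs f ≋ qSum xs g
qSum-cong-All []               = ≋-refl
qSum-cong-All {xs = x ∷ xs} (e ∷ es) = +-cong e (*-congˡ {X} (qSum-cong-All es))

qSum-cong : (xs : List A) {f g : A → Poly} → (∀ x → f x ≋ g x) → qSum xs f ≋ qSum xs g
qSum-cong xs e = qSum-cong-All {xs = xs} (All.tabulate (λ {x} _ → e x))

qSum-+ : (xs : List A) (f g : A → Poly) → qSum xs (λ x → f x +P g x) ≋ qSum xs f +P qSum xs g
qSum-+ []       f g = ≋-sym (+-identityˡ 0P)
qSum-+ (x ∷ xs) f g =
  ≋-trans (+-congˡ {f x +P g x} (*-congˡ {X} (qSum-+ xs f g))) (regroup (f x) (g x) X (qSum xs f) (qSum xs g))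
  where
  regroup : ∀ a b y u v → (a +P b) +P y *P (u +P v) ≋ (a +P y *P u) +P (b +P y *P v)
  regroup = solve-∀ Poly-ring

qSum-distribˡ : (xs : List A) (c : Poly) (f : A → Poly) → qSum xs (λ x → c *P f x) ≋ c *P qSum xs f
qSum-distribˡ []       c f = ≋-sym (zeroʳ c)
qSum-distribˡ (x ∷ xs) c f =
  ≋-trans (+-congˡ {c *P f x} (*-congˡ {X} (qSum-distribˡ xs c f))) (regroup c (f x) X (qSum xs f))
  where
  regroup : ∀ c a y u → c *P a +P y *P (c *P u) ≋ c *P (a +P y *P u)
  regroup = solve-∀ Poly-ring

qSum-∑ : (xs : List A) (ys : List B) (g : A → B → Poly) → qSum xs (λ x → ∑ ys (g x)) ≋ ∑[ y ∈ ys ] qSum xs (λ x → g x y)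
qSum-∑ []       ys g = ≋-sym (∑-zero ys (λ _ → ≋-refl))
qSum-∑ (x ∷ xs) ys g = begin
  ∑ ys (g x) +P X *P qSum xs (λ x → ∑ ys (g x))             ≈⟨ +-congˡ {∑ ys (g x)} (*-congˡ {X} (qSum-∑ xs ys g)) ⟩
  ∑ ys (g x) +P X *P ∑[ y ∈ ys ] qSum xs (λ x → g x y)      ≈⟨ +-congˡ {∑ ys (g x)} (∑-distribˡ ys X (λ y → qSum xs (λ x → g x y))) ⟨
  ∑ ys (g x) +P ∑[ y ∈ ys ] (X *P qSum xs (λ x → g x y))    ≈⟨ ∑-+ ys (g x) (λ y → X *P qSum xs (λ x → g x y)) ⟨
  ∑[ y ∈ ys ] qSum (x ∷ xs) (λ x → g x y)                   ∎
  where open ≋-Reasoning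

rowRemovalSum : ℕ → List ℕ → Poly
rowRemovalSum j ls = qSum (removals ls) (λ bμ → qpow (proj₁ bμ) *P rook j (proj₂ bμ))

∸-suc : ∀ n j → j < n → n ∸ j ≡ suc (n ∸ suc j)
∸-suc (suc n) zero    _         = refl
∸-suc (suc n) (suc j) (s≤s j<n) = ∸-suc n j j<n

zero-factor : ∀ {r} u v → r ≋ 0P → r *P u ≋ r *P v
zero-factor {r} u v r≋0 = ≋-trans (*-congʳ {u} r≋0) (≋-trans (zeroˡ u) (≋-sym (≋-trans (*-congʳ {v} r≋0) (zeroˡ v))))

-- Outside j ≤ a and j ≤ length ls the two factors differ, but then R_j(ls) vanishes.
rook-leadingCoefficient : ∀ a ls j → AllPairs _≥_ ls → All (_≤ a) ls →
  rook j ls *P (qpow a +P X *P (qpow (a ∸ j) *P (qpow j *P qint (length ls ∸ j))))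
  ≋ rook j ls *P (qpow j *P (qint (suc (length ls) ∸ j) *P qpow (a ∸ j)))
rook-leadingCoefficient a ls j d h with j ≤? a | j ≤? length ls
... | yes j≤a | yes j≤n = *-congˡ {rook j ls} (begin
  qpow a +P X *P (qpow (a ∸ j) *P (qpow j *P qint (n ∸ j)))   ≡⟨ cong (λ e → qpow e +P X *P (qpow (a ∸ j) *P (qpow j *P qint (n ∸ j)))) (ℕ.m∸n+n≡m j≤a) ⟨
  qpow (a ∸ j + j) +P X *P (qpow (a ∸ j) *P (qpow j *P qint (n ∸ j)))
    ≈⟨ +-congʳ {X *P (qpow (a ∸ j) *P (qpow j *P qint (n ∸ j)))} (qpow-+ (a ∸ j) j) ⟩
  qpow (a ∸ j) *P qpow j +P X *P (qpow (a ∸ j) *P (qpow j *P qint (n ∸ j)))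
    ≈⟨ factor (qpow (a ∸ j)) (qpow j) (qint (n ∸ j)) ⟩
  qpow j *P ((1P +P X *P qint (n ∸ j)) *P qpow (a ∸ j))
    ≈⟨ *-congˡ {qpow j} (*-congʳ {qpow (a ∸ j)} (qint-suc (n ∸ j))) ⟨
  qpow j *P (qint (suc (n ∸ j)) *P qpow (a ∸ j))
    ≡⟨ cong (λ e → qpow j *P (qint e *P qpow (a ∸ j))) (ℕ.+-∸-assoc 1 j≤n) ⟨
  qpow j *P (qint (suc n ∸ j) *P qpow (a ∸ j)) ∎)
  where
  open ≋-Reasoning
  n = length ls
  factor : ∀ t u v → t *P u +P X *P (t *P (u *P v)) ≋ u *P ((1P +P X *P v) *P t)
  factor = solve-∀ Poly-ring
... | no j≰a | _      = zero-factor _ _ (rook-tooWide j j≰a)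
  where
  rook-tooWide : ∀ j → ¬ j ≤ a → rook j ls ≋ 0P
  rook-tooWide zero    j≰a = contradiction z≤n j≰a
  rook-tooWide (suc j) j≰a = rook-vanish-width ls j d (All.map (λ b≤a → ℕ.≤-trans b≤a (ℕ.≤-pred (ℕ.≰⇒> j≰a))) h)
... | yes _ | no j≰n = zero-factor _ _ (rook-vanish-length ls j d (ℕ.≰⇒> j≰n))

qSum-firstRowOccupied : ∀ a ls j → (∀ i → rowRemovalSum i ls ≋ qpow i *P (qint (length ls ∸ i) *P rook i ls)) →
  X *P qSum (removals ls) (λ bμ → qpow (proj₁ bμ) *P firstRowOccupied a (proj₂ bμ) j)
  ≋ qpow j *P (qint (suc (length ls) ∸ j) *P firstRowOccupied a ls j)
qSum-firstRowOccupied a ls zero    ih = begin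
  X *P qSum (removals ls) (λ bμ → qpow (proj₁ bμ) *P 0P)  ≈⟨ *-congˡ {X} (qSum-cong (removals ls) (λ bμ → zeroʳ (qpow (proj₁ bμ)))) ⟩
  X *P qSum (removals ls) (λ _ → 0P *P 0P)                ≈⟨ *-congˡ {X} (qSum-distribˡ (removals ls) 0P (λ _ → 0P)) ⟩
  X *P 0P                                                 ≈⟨ zeroʳ X ⟩
  0P                                                      ≈⟨ ≋-trans (*-congˡ {1P} (zeroʳ (qint (suc (length ls))))) (zeroʳ 1P) ⟨
  qpow 0 *P (qint (suc (length ls)) *P 0P)                ∎
  where open ≋-Reasoning
qSum-firstRowOccupied a ls (suc j) ih = begin
  X *P qSum (removals ls) (λ bμ → qpow (proj₁ bμ) *P (qint (a ∸ j) *P rook j (proj₂ bμ)))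
    ≈⟨ *-congˡ {X} (qSum-cong (removals ls) (λ bμ → swap (qpow (proj₁ bμ)) (qint (a ∸ j)) (rook j (proj₂ bμ)))) ⟩
  X *P qSum (removals ls) (λ bμ → qint (a ∸ j) *P (qpow (proj₁ bμ) *P rook j (proj₂ bμ)))
    ≈⟨ *-congˡ {X} (qSum-distribˡ (removals ls) (qint (a ∸ j)) _) ⟩
  X *P (qint (a ∸ j) *P rowRemovalSum j ls)
    ≈⟨ *-congˡ {X} (*-congˡ {qint (a ∸ j)} (ih j)) ⟩
  X *P (qint (a ∸ j) *P (qpow j *P (qint (length ls ∸ j) *P rook j ls)))
    ≈⟨ regroup X (qint (a ∸ j)) (qpow j) (qint (length ls ∸ j)) (rook j ls) ⟩
  (X *P qpow j) *P (qint (length ls ∸ j) *P (qint (a ∸ j) *P rook j ls))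
    ≈⟨ *-congʳ {qint (length ls ∸ j) *P (qint (a ∸ j) *P rook j ls)} (qpow-suc j) ⟨
  qpow (suc j) *P (qint (length ls ∸ j) *P (qint (a ∸ j) *P rook j ls)) ∎
  where
  open ≋-Reasoning
  swap : ∀ u v w → u *P (v *P w) ≋ v *P (u *P w)
  swap = solve-∀ Poly-ring
  regroup : ∀ x c u v r → x *P (c *P (u *P (v *P r))) ≋ (x *P u) *P (v *P (c *P r))
  regroup = solve-∀ Poly-ring

rowRemovalSum-rook : ∀ ls j → AllPairs _≥_ ls → rowRemovalSum j ls ≋ qpow j *P (qint (length ls ∸ j) *P rook j ls)
rowRemovalSum-rook []       j [] =
  ≋-sym (≋-trans (*-congˡ {qpow j} (≡⇒≋ (cong (λ n → qint n *P rook j []) (ℕ.0∸n≡0 j)))) (zeroʳ (qpow j)))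
rowRemovalSum-rook (a ∷ ls) j (h ∷ d) = begin
  rowRemovalSum j (a ∷ ls)
    ≡⟨ cong (λ s → qpow a *P R +P X *P s) (qSum-map (removals ls) _ _) ⟩
  qpow a *P R +P X *P qSum (removals ls) (λ bμ → qpow (proj₁ bμ) *P rook j (a ∷ proj₂ bμ))
    ≈⟨ +-congˡ {qpow a *P R} (*-congˡ {X} (qSum-cong-All (All.map (λ {bμ} → expand bμ) (removals-All ls h)))) ⟩
  qpow a *P R +P X *P qSum (removals ls) (λ bμ → qpow (a ∸ j) *P (qpow (proj₁ bμ) *P rook j (proj₂ bμ)) +P G bμ)
    ≈⟨ +-congˡ {qpow a *P R} (*-congˡ {X} (≋-trans (qSum-+ (removals ls) _ G)
                                                   (+-congʳ {qSum (removals ls) G} (qSum-distribˡ (removals ls) (qpow (a ∸ j)) _)))) ⟩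
  qpow a *P R +P X *P (qpow (a ∸ j) *P rowRemovalSum j ls +P qSum (removals ls) G)
    ≈⟨ +-congˡ {qpow a *P R} (*-congˡ {X} (+-congʳ {qSum (removals ls) G} (*-congˡ {qpow (a ∸ j)} (rowRemovalSum-rook ls j d)))) ⟩
  qpow a *P R +P X *P (qpow (a ∸ j) *P (qpow j *P (qint (n ∸ j) *P R)) +P qSum (removals ls) G)
    ≈⟨ regroup (qpow a) R X (qpow (a ∸ j)) (qpow j) (qint (n ∸ j)) (qSum (removals ls) G) ⟩
  R *P (qpow a +P X *P (qpow (a ∸ j) *P (qpow j *P qint (n ∸ j)))) +P X *P qSum (removals ls) G
    ≈⟨ +-cong (rook-leadingCoefficient a ls j d h) (qSum-firstRowOccupied a ls j (λ i → rowRemovalSum-rook ls i d)) ⟩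
  R *P (qpow j *P (qint (suc n ∸ j) *P qpow (a ∸ j))) +P qpow j *P (qint (suc n ∸ j) *P firstRowOccupied a ls j)
    ≈⟨ factor R (qpow j) (qint (suc n ∸ j)) (qpow (a ∸ j)) (firstRowOccupied a ls j) ⟩
  qpow j *P (qint (suc n ∸ j) *P (qpow (a ∸ j) *P R +P firstRowOccupied a ls j))
    ≈⟨ *-congˡ {qpow j} (*-congˡ {qint (suc n ∸ j)} (rook-cons a ls j h)) ⟨
  qpow j *P (qint (suc n ∸ j) *P rook j (a ∷ ls)) ∎
  where
  open ≋-Reasoning
  n = length ls
  R = rook j ls
  G : ℕ × List ℕ → Poly
  G bμ = qpow (proj₁ bμ) *P firstRowOccupied a (proj₂ bμ) j
  expand : ∀ bμ → All (_≤ a) (proj₂ bμ) →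
           qpow (proj₁ bμ) *P rook j (a ∷ proj₂ bμ) ≋ qpow (a ∸ j) *P (qpow (proj₁ bμ) *P rook j (proj₂ bμ)) +P G bμ
  expand (b , μ) hμ =
    ≋-trans (*-congˡ {qpow b} (rook-cons a μ j hμ)) (distrib (qpow b) (qpow (a ∸ j)) (rook j μ) (firstRowOccupied a μ j))
    where
    distrib : ∀ u v r f → u *P (v *P r +P f) ≋ v *P (u *P r) +P u *P f
    distrib = solve-∀ Poly-ring
  regroup : ∀ t R x u v w g → t *P R +P x *P (u *P (v *P (w *P R)) +P g) ≋ R *P (t +P x *P (u *P (v *P w))) +P x *P g
  regroup = solve-∀ Poly-ring
  factor : ∀ R u w t f → R *P (u *P (w *P t)) +P u *P (w *P f) ≋ u *P (w *P (t *P R +P f))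
  factor = solve-∀ Poly-ring

-- Coefficients of (x;q)_j

coeffX-+X : ∀ p r k → coeffX (p +X r) k ≋ coeffX p k +P coeffX r k
coeffX-+X []      r       k       = ≋-sym (+-identityˡ (coeffX r k))
coeffX-+X (a ∷ p) []      k       = ≋-sym (+-identityʳ (coeffX (a ∷ p) k))
coeffX-+X (a ∷ p) (b ∷ r) zero    = ≋-refl
coeffX-+X (a ∷ p) (b ∷ r) (suc k) = coeffX-+X p r k

coeffX-·X : ∀ c p k → coeffX (c ·X p) k ≋ c *P coeffX p k
coeffX-·X c []      k       = ≋-sym (zeroʳ c)
coeffX-·X c (a ∷ p) zero    = ≋-refl
coeffX-·X c (a ∷ p) (suc k) = coeffX-·X c p k

coeffX-*X-linear-zero : ∀ p u v → coeffX (p *X (u ∷ v ∷ [])) 0 ≋ coeffX p 0 *P u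
coeffX-*X-linear-zero []      u v = ≋-refl
coeffX-*X-linear-zero (a ∷ p) u v = +-identityʳ (a *P u)

coeffX-*X-linear-suc : ∀ p u v k → coeffX (p *X (u ∷ v ∷ [])) (suc k) ≋ coeffX p (suc k) *P u +P coeffX p k *P v
coeffX-*X-linear-suc []      u v k       = ≋-refl
coeffX-*X-linear-suc (a ∷ p) u v zero    =
  ≋-trans (coeffX-+X ((a *P v) ∷ []) (p *X (u ∷ v ∷ [])) 0)
          (≋-trans (+-congˡ {a *P v} (coeffX-*X-linear-zero p u v)) (+-comm (a *P v) (coeffX p 0 *P u)))
coeffX-*X-linear-suc (a ∷ p) u v (suc k) =
  ≋-trans (coeffX-+X ((a *P v) ∷ []) (p *X (u ∷ v ∷ [])) (suc k)) (coeffX-*X-linear-suc p u v k)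

qpochCoeff : ℕ → ℕ → Poly
qpochCoeff j k = coeffX (qpoch j) k

qpochCoeff-suc-zero : ∀ j → qpochCoeff (suc j) 0 ≋ qpochCoeff j 0
qpochCoeff-suc-zero j = ≋-trans (coeffX-*X-linear-zero (qpoch j) 1P (-P qpow j)) (*-identityʳ (qpochCoeff j 0))

qpochCoeff-suc-suc : ∀ j k → qpochCoeff (suc j) (suc k) ≋ qpochCoeff j (suc k) +P -P (qpow j *P qpochCoeff j k)
qpochCoeff-suc-suc j k =
  ≋-trans (coeffX-*X-linear-suc (qpoch j) 1P (-P qpow j) k) (regroup (qpochCoeff j (suc k)) (qpochCoeff j k) (qpow j))
  where
  regroup : ∀ a b c → a *P 1P +P b *P (-P c) ≋ a +P -P (c *P b)
  regroup = solve-∀ Poly-ring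

qpochCoeff-vanish : ∀ j k → j < k → qpochCoeff j k ≋ 0P
qpochCoeff-vanish zero    (suc k) _         = ≋-refl
qpochCoeff-vanish (suc j) (suc k) (s≤s j<k) = begin
  qpochCoeff (suc j) (suc k)                            ≈⟨ qpochCoeff-suc-suc j k ⟩
  qpochCoeff j (suc k) +P -P (qpow j *P qpochCoeff j k) ≈⟨ +-cong (qpochCoeff-vanish j (suc k) (ℕ.m≤n⇒m≤1+n j<k))
                                                                   (-‿cong (*-congˡ {qpow j} (qpochCoeff-vanish j k j<k))) ⟩
  0P +P -P (qpow j *P 0P)                               ≈⟨ -‿cong (zeroʳ (qpow j)) ⟩
  0P                                                    ∎
  where open ≋-Reasoning

QpochRatio : ℕ → ℕ → Set
QpochRatio j k = qint (suc k) *P qpochCoeff j (suc k) +P qpow k *P (qint (j ∸ k) *P qpochCoeff j k) ≋ 0P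

qpochRatio-step : ∀ j k → suc k ≤ j → QpochRatio j (suc k) → QpochRatio j k → QpochRatio (suc j) (suc k)
qpochRatio-step j k k<j ratio-k+1 ratio-k = begin
  qint (suc (suc k)) *P qpochCoeff (suc j) (suc (suc k)) +P qpow (suc k) *P (qint (j ∸ k) *P qpochCoeff (suc j) (suc k))
    ≈⟨ +-cong (*-cong (qint-suc (suc k)) (qpochCoeff-suc-suc j (suc k)))
              (*-cong (qpow-suc k) (*-cong S+t (qpochCoeff-suc-suc j k))) ⟩
  (1P +P X *P K) *P (c₂ +P -P (qj *P c₁)) +P (X *P qk) *P ((S +P t) *P (c₁ +P -P (qj *P c₀)))
    ≈⟨ regroup X K c₂ c₁ c₀ qj qk S t ⟩
  (((1P +P X *P K) *P c₂ +P (X *P qk) *P (S *P c₁)) +P -P (X *P (qj *P (K *P c₁ +P qk *P ((S +P t) *P c₀)))))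
    +P c₁ *P ((X *P qk) *P t +P -P qj)
    ≈⟨ +-cong (+-cong ratio-k+1′ (-‿cong (*-congˡ {X} (*-congˡ {qj} ratio-k′)))) (*-congˡ {c₁} (+-congʳ { -P qj} q-exponents)) ⟩
  (0P +P -P (X *P (qj *P 0P))) +P c₁ *P (qj +P -P qj)
    ≈⟨ vanish X qj c₁ ⟩
  0P ∎
  where
  open ≋-Reasoning
  K = qint (suc k)
  c₂ = qpochCoeff j (suc (suc k))
  c₁ = qpochCoeff j (suc k)
  c₀ = qpochCoeff j k
  qj = qpow j
  qk = qpow k
  S = qint (j ∸ suc k)
  t = qpow (j ∸ suc k)
  S+t : qint (j ∸ k) ≋ S +P t
  S+t = ≋-trans (≡⇒≋ (cong qint (∸-suc j k k<j))) (qint-sucʳ (j ∸ suc k))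
  ratio-k+1′ : (1P +P X *P K) *P c₂ +P (X *P qk) *P (S *P c₁) ≋ 0P
  ratio-k+1′ = ≋-trans (+-cong (*-congʳ {c₂} (≋-sym (qint-suc (suc k)))) (*-congʳ {S *P c₁} (≋-sym (qpow-suc k)))) ratio-k+1
  ratio-k′ : K *P c₁ +P qk *P ((S +P t) *P c₀) ≋ 0P
  ratio-k′ = ≋-trans (+-congˡ {K *P c₁} (*-congˡ {qk} (*-congʳ {c₀} (≋-sym S+t)))) ratio-k
  q-exponents : (X *P qk) *P t ≋ qj
  q-exponents = ≋-trans (*-congʳ {t} (≋-sym (qpow-suc k)))
                        (≋-trans (≋-sym (qpow-+ (suc k) (j ∸ suc k))) (≡⇒≋ (cong qpow (ℕ.m+[n∸m]≡n k<j))))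
  -- Expanding by the recursion of the coefficients, the ratio relation for (j+1, k+1) is
  -- that for (j, k+1) minus q^(j+1) times that for (j, k), plus c₁ (q^(k+1) q^(j-k-1) - q^j).
  regroup : ∀ X K c₂ c₁ c₀ qj qk S t →
    (1P +P X *P K) *P (c₂ +P -P (qj *P c₁)) +P (X *P qk) *P ((S +P t) *P (c₁ +P -P (qj *P c₀)))
    ≋ (((1P +P X *P K) *P c₂ +P (X *P qk) *P (S *P c₁)) +P -P (X *P (qj *P (K *P c₁ +P qk *P ((S +P t) *P c₀)))))
      +P c₁ *P ((X *P qk) *P t +P -P qj)
  regroup = solve-∀ Poly-ring
  vanish : ∀ X qj c → (0P +P -P (X *P (qj *P 0P))) +P c *P (qj +P -P qj) ≋ 0P
  vanish = solve-∀ Poly-ring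

qpochCoeff-ratio : ∀ j k → QpochRatio j k
qpochCoeff-ratio zero    k = begin
  qint (suc k) *P 0P +P qpow k *P (qint (0 ∸ k) *P qpochCoeff 0 k) ≡⟨ cong (λ n → qint (suc k) *P 0P +P qpow k *P (qint n *P qpochCoeff 0 k)) (ℕ.0∸n≡0 k) ⟩
  qint (suc k) *P 0P +P qpow k *P 0P                                ≈⟨ +-cong (zeroʳ (qint (suc k))) (zeroʳ (qpow k)) ⟩
  0P +P 0P                                                          ≈⟨ +-identityʳ 0P ⟩
  0P                                                                ∎
  where open ≋-Reasoning
qpochCoeff-ratio (suc j) zero = begin
  1P *P qpochCoeff (suc j) 1 +P 1P *P (qint (suc j) *P qpochCoeff (suc j) 0)
    ≈⟨ +-cong (*-congˡ {1P} (qpochCoeff-suc-suc j 0)) (*-congˡ {1P} (*-cong (qint-sucʳ j) (qpochCoeff-suc-zero j))) ⟩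
  1P *P (c₁ +P -P (qpow j *P c₀)) +P 1P *P ((qint j +P qpow j) *P c₀)
    ≈⟨ cancel c₁ c₀ (qpow j) (qint j) ⟩
  1P *P c₁ +P 1P *P (qint j *P c₀)
    ≈⟨ qpochCoeff-ratio j 0 ⟩
  0P ∎
  where
  open ≋-Reasoning
  c₁ = qpochCoeff j 1
  c₀ = qpochCoeff j 0
  cancel : ∀ c₁ c₀ u s → 1P *P (c₁ +P -P (u *P c₀)) +P 1P *P ((s +P u) *P c₀) ≋ 1P *P c₁ +P 1P *P (s *P c₀)
  cancel = solve-∀ Poly-ring
qpochCoeff-ratio (suc j) (suc k) with suc k ≤? j
... | yes k<j = qpochRatio-step j k k<j (qpochCoeff-ratio j (suc k)) (qpochCoeff-ratio j k)
... | no k≮j = begin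
  qint (suc (suc k)) *P qpochCoeff (suc j) (suc (suc k)) +P qpow (suc k) *P (qint (j ∸ k) *P qpochCoeff (suc j) (suc k))
    ≈⟨ +-cong (*-congˡ {qint (suc (suc k))} (qpochCoeff-vanish (suc j) (suc (suc k)) (s≤s j<1+k)))
              (*-congˡ {qpow (suc k)} (≡⇒≋ (cong (λ n → qint n *P qpochCoeff (suc j) (suc k)) (ℕ.m≤n⇒m∸n≡0 (ℕ.≤-pred j<1+k))))) ⟩
  qint (suc (suc k)) *P 0P +P qpow (suc k) *P 0P
    ≈⟨ ≋-trans (+-cong (zeroʳ (qint (suc (suc k)))) (zeroʳ (qpow (suc k)))) (+-identityʳ 0P) ⟩
  0P ∎
  where
  open ≋-Reasoning
  j<1+k : j < suc k
  j<1+k = ℕ.≰⇒> k≮j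

∸-split : ∀ k j N → k ≤ j → j ≤ N → N ∸ k ≡ (j ∸ k) + (N ∸ j)
∸-split zero    j       N       _         j≤N       = sym (ℕ.m+[n∸m]≡n j≤N)
∸-split (suc k) (suc j) (suc N) (s≤s k≤j) (s≤s j≤N) = ∸-split k j N k≤j j≤N

qpochCoeff-shift : ∀ N j k → j ≤ N →
  qpow k *P (qint (N ∸ k) *P qpochCoeff j k) +P qint (suc k) *P qpochCoeff j (suc k) ≋ qpow j *P (qint (N ∸ j) *P qpochCoeff j k)
qpochCoeff-shift N j k j≤N with k ≤? j
... | yes k≤j = begin
  qk *P (qint (N ∸ k) *P c₀) +P K *P c₁
    ≈⟨ +-congʳ {K *P c₁} (*-congˡ {qk} (*-congʳ {c₀} (≋-trans (≡⇒≋ (cong qint (∸-split k j N k≤j j≤N))) (qint-+ (j ∸ k) (N ∸ j))))) ⟩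
  qk *P ((qint (j ∸ k) +P qpow (j ∸ k) *P qint (N ∸ j)) *P c₀) +P K *P c₁
    ≈⟨ regroup qk (qint (j ∸ k)) (qpow (j ∸ k)) (qint (N ∸ j)) c₀ K c₁ ⟩
  (K *P c₁ +P qk *P (qint (j ∸ k) *P c₀)) +P (qk *P qpow (j ∸ k)) *P (qint (N ∸ j) *P c₀)
    ≈⟨ +-cong (qpochCoeff-ratio j k) (*-congʳ {qint (N ∸ j) *P c₀} q-exponents) ⟩
  0P +P qpow j *P (qint (N ∸ j) *P c₀)
    ≈⟨ +-identityˡ _ ⟩
  qpow j *P (qint (N ∸ j) *P c₀) ∎
  where
  open ≋-Reasoning
  qk = qpow k
  K = qint (suc k)
  c₀ = qpochCoeff j k
  c₁ = qpochCoeff j (suc k)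
  regroup : ∀ qk S t Q c₀ K c₁ → qk *P ((S +P t *P Q) *P c₀) +P K *P c₁ ≋ (K *P c₁ +P qk *P (S *P c₀)) +P (qk *P t) *P (Q *P c₀)
  regroup = solve-∀ Poly-ring
  q-exponents : qk *P qpow (j ∸ k) ≋ qpow j
  q-exponents = ≋-trans (≋-sym (qpow-+ k (j ∸ k))) (≡⇒≋ (cong qpow (ℕ.m+[n∸m]≡n k≤j)))
... | no k≰j = begin
  qpow k *P (qint (N ∸ k) *P qpochCoeff j k) +P qint (suc k) *P qpochCoeff j (suc k)
    ≈⟨ +-cong (*-congˡ {qpow k} (*-congˡ {qint (N ∸ k)} (qpochCoeff-vanish j k j<k)))
              (*-congˡ {qint (suc k)} (qpochCoeff-vanish j (suc k) (ℕ.m≤n⇒m≤1+n j<k))) ⟩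
  qpow k *P (qint (N ∸ k) *P 0P) +P qint (suc k) *P 0P
    ≈⟨ vanish (qpow k) (qint (N ∸ k)) (qint (suc k)) ⟩
  0P
    ≈⟨ vanish′ (qpow j) (qint (N ∸ j)) ⟨
  qpow j *P (qint (N ∸ j) *P 0P)
    ≈⟨ *-congˡ {qpow j} (*-congˡ {qint (N ∸ j)} (qpochCoeff-vanish j k j<k)) ⟨
  qpow j *P (qint (N ∸ j) *P qpochCoeff j k) ∎
  where
  open ≋-Reasoning
  j<k = ℕ.≰⇒> k≰j
  vanish : ∀ u v w → u *P (v *P 0P) +P w *P 0P ≋ 0P
  vanish = solve-∀ Poly-ring
  vanish′ : ∀ u v → u *P (v *P 0P) ≋ 0P
  vanish′ = solve-∀ Poly-ring

-- Expanding the numerators of H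

-- The numerator of H^{m,n}_k(λ) for the rows L of λ (definitionally coeffX (HSum m n λ) k).
numH : ℕ → ℕ → List ℕ → ℕ → Poly
numH m n L k = coeffX (foldr _+X_ [] (map (λ i → (sgn i ·P ((rook i L *P qfact (m ∸ i)) *P qpow (m * i ∸ choose2 i))) ·X qpoch i)
                                         (upTo (suc n)))) k

-- The coefficient of R_j(λ) (x;q)_j in Σ_i H_i x^i, up to the common denominator.
weight : ℕ → ℕ → Poly
weight m j = (sgn j ∷ []) *P (qfact (m ∸ j) *P qpow (m * j ∸ choose2 j))

·P≋*P : ∀ c p → c ·P p ≋ (c ∷ []) *P p
·P≋*P c p = mk λ d → sym (trans (coeff-+P (c ·P p) (+ 0 ∷ []) d)
                               (trans (cong (coeff (c ·P p) d +ℤ_) (coeff-0∷[] d)) (ℤ.+-identityʳ _)))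

coeffX-foldr : (xs : List A) (g : A → XPoly) (k : ℕ) → coeffX (foldr _+X_ [] (map g xs)) k ≋ ∑[ x ∈ xs ] coeffX (g x) k
coeffX-foldr []       g k = ≋-refl
coeffX-foldr (x ∷ xs) g k =
  ≋-trans (coeffX-+X (g x) (foldr _+X_ [] (map g xs)) k) (+-congˡ {coeffX (g x) k} (coeffX-foldr xs g k))

numH-expand : ∀ m n L k → numH m n L k ≋ ∑[ j ∈ upTo (suc n) ] ((weight m j *P qpochCoeff j k) *P rook j L)
numH-expand m n L k =
  ≋-trans (coeffX-foldr (upTo (suc n)) (λ j → (sgn j ·P ((rook j L *P qfact (m ∸ j)) *P qpow (m * j ∸ choose2 j))) ·X qpoch j) k)
          (∑-cong (upTo (suc n)) term)
  where
  term : ∀ j → coeffX ((sgn j ·P ((rook j L *P qfact (m ∸ j)) *P qpow (m * j ∸ choose2 j))) ·X qpoch j) k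
               ≋ (weight m j *P qpochCoeff j k) *P rook j L
  term j = begin
    coeffX ((sgn j ·P ((R *P F) *P Q)) ·X qpoch j) k  ≈⟨ coeffX-·X (sgn j ·P ((R *P F) *P Q)) (qpoch j) k ⟩
    (sgn j ·P ((R *P F) *P Q)) *P qpochCoeff j k      ≈⟨ *-congʳ {qpochCoeff j k} (·P≋*P (sgn j) ((R *P F) *P Q)) ⟩
    ((sgn j ∷ []) *P ((R *P F) *P Q)) *P qpochCoeff j k ≈⟨ regroup (sgn j ∷ []) R F Q (qpochCoeff j k) ⟩
    (weight m j *P qpochCoeff j k) *P R               ∎
    where
    open ≋-Reasoning
    R = rook j L
    F = qfact (m ∸ j)
    Q = qpow (m * j ∸ choose2 j)
    regroup : ∀ s R F Q c → (s *P ((R *P F) *P Q)) *P c ≋ ((s *P (F *P Q)) *P c) *P R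
    regroup = solve-∀ Poly-ring

rowRemoval-numH : ∀ m n k L → AllPairs _≥_ L → length L ≡ suc n →
  qSum (removals L) (λ bμ → qpow (proj₁ bμ) *P numH m n (proj₂ bμ) k)
  ≋ ∑[ j ∈ upTo (suc n) ] ((weight m j *P qpochCoeff j k) *P (qpow j *P (qint (suc n ∸ j) *P rook j L)))
rowRemoval-numH m n k L d |L| = begin
  qSum (removals L) (λ bμ → qpow (proj₁ bμ) *P numH m n (proj₂ bμ) k)
    ≈⟨ qSum-cong (removals L) (λ bμ → ≋-trans (*-congˡ {qpow (proj₁ bμ)} (numH-expand m n (proj₂ bμ) k))
                                             (≋-sym (∑-distribˡ (upTo (suc n)) (qpow (proj₁ bμ)) _))) ⟩
  qSum (removals L) (λ bμ → ∑[ j ∈ upTo (suc n) ] (qpow (proj₁ bμ) *P ((w j) *P rook j (proj₂ bμ))))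
    ≈⟨ qSum-∑ (removals L) (upTo (suc n)) _ ⟩
  ∑[ j ∈ upTo (suc n) ] qSum (removals L) (λ bμ → qpow (proj₁ bμ) *P (w j *P rook j (proj₂ bμ)))
    ≈⟨ ∑-cong (upTo (suc n)) (λ j → ≋-trans (qSum-cong (removals L) (λ bμ → swap (qpow (proj₁ bμ)) (w j) (rook j (proj₂ bμ))))
                                            (qSum-distribˡ (removals L) (w j) _)) ⟩
  ∑[ j ∈ upTo (suc n) ] (w j *P rowRemovalSum j L)
    ≈⟨ ∑-cong (upTo (suc n)) (λ j → *-congˡ {w j} (≋-trans (rowRemovalSum-rook L j d)
                                       (≡⇒≋ (cong (λ l → qpow j *P (qint (l ∸ j) *P rook j L)) |L|)))) ⟩
  ∑[ j ∈ upTo (suc n) ] (w j *P (qpow j *P (qint (suc n ∸ j) *P rook j L))) ∎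
  where
  open ≋-Reasoning
  w : ℕ → Poly
  w j = weight m j *P qpochCoeff j k
  swap : ∀ u v r → u *P (v *P r) ≋ v *P (u *P r)
  swap = solve-∀ Poly-ring

qpochCoeff-shift-weighted : ∀ m N L k j → j ≤ N →
  (qpow k *P qint (N ∸ k)) *P ((weight m j *P qpochCoeff j k) *P rook j L)
    +P qint (k + 1) *P ((weight m j *P qpochCoeff j (k + 1)) *P rook j L)
  ≋ (weight m j *P qpochCoeff j k) *P (qpow j *P (qint (N ∸ j) *P rook j L))
qpochCoeff-shift-weighted m N L k j j≤N = begin
  (qpow k *P qint (N ∸ k)) *P ((w *P c₀) *P R) +P qint (k + 1) *P ((w *P qpochCoeff j (k + 1)) *P R)
    ≡⟨ cong (λ i → (qpow k *P qint (N ∸ k)) *P ((w *P c₀) *P R) +P qint i *P ((w *P qpochCoeff j i) *P R)) (ℕ.+-comm k 1) ⟩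
  (qpow k *P qint (N ∸ k)) *P ((w *P c₀) *P R) +P qint (suc k) *P ((w *P c₁) *P R)
    ≈⟨ factor (qpow k) (qint (N ∸ k)) (qint (suc k)) w c₀ c₁ R ⟩
  (w *P R) *P (qpow k *P (qint (N ∸ k) *P c₀) +P qint (suc k) *P c₁)
    ≈⟨ *-congˡ {w *P R} (qpochCoeff-shift N j k j≤N) ⟩
  (w *P R) *P (qpow j *P (qint (N ∸ j) *P c₀))
    ≈⟨ regroup w R (qpow j) (qint (N ∸ j)) c₀ ⟩
  (w *P c₀) *P (qpow j *P (qint (N ∸ j) *P R)) ∎
  where
  open ≋-Reasoning
  w = weight m j
  R = rook j L
  c₀ = qpochCoeff j k
  c₁ = qpochCoeff j (suc k)
  factor : ∀ u S K w c₀ c₁ R → (u *P S) *P ((w *P c₀) *P R) +P K *P ((w *P c₁) *P R) ≋ (w *P R) *P (u *P (S *P c₀) +P K *P c₁)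
  factor = solve-∀ Poly-ring
  regroup : ∀ w R u S c → (w *P R) *P (u *P (S *P c)) ≋ (w *P c) *P (u *P (S *P R))
  regroup = solve-∀ Poly-ring

shift-numH : ∀ m N L k →
  (qpow k *P qint (N ∸ k)) *P numH m N L k +P qint (k + 1) *P numH m N L (k + 1)
  ≋ ∑[ j ∈ upTo N ] ((weight m j *P qpochCoeff j k) *P (qpow j *P (qint (N ∸ j) *P rook j L)))
shift-numH m N L k = begin
  Aₖ *P numH m N L k +P Bₖ *P numH m N L (k + 1)
    ≈⟨ +-cong (*-congˡ {Aₖ} (numH-expand m N L k)) (*-congˡ {Bₖ} (numH-expand m N L (k + 1))) ⟩
  Aₖ *P ∑ (upTo (suc N)) (f k) +P Bₖ *P ∑ (upTo (suc N)) (f (k + 1))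
    ≈⟨ +-cong (∑-distribˡ (upTo (suc N)) Aₖ (f k)) (∑-distribˡ (upTo (suc N)) Bₖ (f (k + 1))) ⟨
  ∑[ j ∈ upTo (suc N) ] (Aₖ *P f k j) +P ∑[ j ∈ upTo (suc N) ] (Bₖ *P f (k + 1) j)
    ≈⟨ ∑-+ (upTo (suc N)) (λ j → Aₖ *P f k j) (λ j → Bₖ *P f (k + 1) j) ⟨
  ∑[ j ∈ upTo (suc N) ] (Aₖ *P f k j +P Bₖ *P f (k + 1) j)
    ≈⟨ ∑-cong-All (All.map (λ {j} j<1+N → qpochCoeff-shift-weighted m N L k j (ℕ.≤-pred j<1+N)) (All-upTo (suc N))) ⟩
  ∑[ j ∈ upTo (suc N) ] D j
    ≡⟨ cong (λ js → ∑ js D) (List.upTo-∷ʳ N) ⟨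
  ∑ (upTo N ++ N ∷ []) D
    ≈⟨ ∑-++ (upTo N) (N ∷ []) D ⟩
  ∑ (upTo N) D +P (D N +P 0P)
    ≈⟨ +-congˡ {∑ (upTo N) D} (≋-trans (+-identityʳ (D N)) last-vanishes) ⟩
  ∑ (upTo N) D +P 0P
    ≈⟨ +-identityʳ (∑ (upTo N) D) ⟩
  ∑ (upTo N) D ∎
  where
  open ≋-Reasoning
  Aₖ = qpow k *P qint (N ∸ k)
  Bₖ = qint (k + 1)
  f : ℕ → ℕ → Poly
  f i j = (weight m j *P qpochCoeff j i) *P rook j L
  D : ℕ → Poly
  D j = (weight m j *P qpochCoeff j k) *P (qpow j *P (qint (N ∸ j) *P rook j L))
  last-vanishes : D N ≋ 0P
  last-vanishes = begin
    D N                                                             ≡⟨ cong (λ i → (weight m N *P qpochCoeff N k) *P (qpow N *P (qint i *P rook N L))) (ℕ.n∸n≡0 N) ⟩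
    (weight m N *P qpochCoeff N k) *P (qpow N *P (0P *P rook N L))  ≈⟨ *-congˡ {weight m N *P qpochCoeff N k} (zeroʳ (qpow N)) ⟩
    (weight m N *P qpochCoeff N k) *P 0P                            ≈⟨ zeroʳ (weight m N *P qpochCoeff N k) ⟩
    0P                                                              ∎

Decreasing⇒AllPairs : ∀ {n} (v : Vec ℕ n) → Decreasing v → AllPairs _≥_ (toList v)
Decreasing⇒AllPairs []ᵥ                 _         = []
Decreasing⇒AllPairs (a ∷ᵥ []ᵥ)          _         = [] ∷ []
Decreasing⇒AllPairs (a ∷ᵥ (b ∷ᵥ v)) (b≤a , d) with Decreasing⇒AllPairs (b ∷ᵥ v) d
... | b≥v ∷ v-sorted = (b≤a ∷ All.map (λ x≤b → ℕ.≤-trans x≤b b≤a) b≥v) ∷ b≥v ∷ v-sorted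

size-removeAt : ∀ n (v : Vec ℕ (suc n)) (i : Fin (suc n)) → size v ≡ lookup v i + size (removeAt v i)
size-removeAt n       (a ∷ᵥ v)          fzero    = refl
size-removeAt (suc n) (a ∷ᵥ (b ∷ᵥ w)) (fsuc i) = begin
  a + size (b ∷ᵥ w)                          ≡⟨ cong (λ s → a + s) (size-removeAt n (b ∷ᵥ w) i) ⟩
  a + (lookup (b ∷ᵥ w) i + size (removeAt (b ∷ᵥ w) i)) ≡⟨ ℕ.+-assoc a _ _ ⟨
  a + lookup (b ∷ᵥ w) i + size (removeAt (b ∷ᵥ w) i)   ≡⟨ cong (_+ size (removeAt (b ∷ᵥ w) i)) (ℕ.+-comm a (lookup (b ∷ᵥ w) i)) ⟩
  lookup (b ∷ᵥ w) i + a + size (removeAt (b ∷ᵥ w) i)   ≡⟨ ℕ.+-assoc (lookup (b ∷ᵥ w) i) a _ ⟩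
  lookup (b ∷ᵥ w) i + (a + size (removeAt (b ∷ᵥ w) i)) ∎
  where open ≡-Reasoning

∑-allFin-suc : ∀ n (f : Fin (suc n) → Poly) → ∑ (allFin (suc n)) f ≡ f fzero +P ∑[ i ∈ allFin n ] f (fsuc i)
∑-allFin-suc n f = cong (f fzero +P_) (trans (cong (λ is → ∑ is f) (sym (List.map-tabulate id fsuc))) (∑-map (allFin n) fsuc f))

∑-allFin-removeAt : ∀ n (v : Vec A (suc n)) (G : A → List A → Poly) →
  ∑[ i ∈ allFin (suc n) ] (qpow (toℕ i) *P G (lookup v i) (toList (removeAt v i)))
  ≋ qSum (removals (toList v)) (λ bμ → G (proj₁ bμ) (proj₂ bμ))
∑-allFin-removeAt zero    (a ∷ᵥ []ᵥ)      G =
  ≋-trans (+-identityʳ (1P *P G a [])) (≋-trans (*-identityˡ (G a [])) (≋-sym (≋-trans (+-congˡ {G a []} (zeroʳ X)) (+-identityʳ (G a [])))))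
∑-allFin-removeAt (suc n) (a ∷ᵥ (b ∷ᵥ w)) G = begin
  ∑[ i ∈ allFin (suc (suc n)) ] F i
    ≡⟨ ∑-allFin-suc (suc n) F ⟩
  F fzero +P ∑[ i ∈ allFin (suc n) ] F (fsuc i)
    ≈⟨ +-cong (*-identityˡ (G a (toList v))) (∑-cong (allFin (suc n)) (λ i → ≋-trans (*-congʳ {G′ i} (qpow-suc (toℕ i))) (*-assoc X (qpow (toℕ i)) (G′ i)))) ⟩
  G a (toList v) +P ∑[ i ∈ allFin (suc n) ] (X *P (qpow (toℕ i) *P G′ i))
    ≈⟨ +-congˡ {G a (toList v)} (∑-distribˡ (allFin (suc n)) X _) ⟩
  G a (toList v) +P X *P ∑[ i ∈ allFin (suc n) ] (qpow (toℕ i) *P G′ i)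
    ≈⟨ +-congˡ {G a (toList v)} (*-congˡ {X} (∑-allFin-removeAt n v (λ c μ → G c (a ∷ μ)))) ⟩
  G a (toList v) +P X *P qSum (removals (toList v)) (λ cμ → G (proj₁ cμ) (a ∷ proj₂ cμ))
    ≡⟨ cong (λ s → G a (toList v) +P X *P s) (qSum-map (removals (toList v)) _ (λ cμ → G (proj₁ cμ) (proj₂ cμ))) ⟨
  qSum (removals (a ∷ toList v)) (λ cμ → G (proj₁ cμ) (proj₂ cμ)) ∎
  where
  open ≋-Reasoning
  v = b ∷ᵥ w
  F : Fin (suc (suc n)) → Poly
  F i = qpow (toℕ i) *P G (lookup (a ∷ᵥ v) i) (toList (removeAt (a ∷ᵥ v) i))
  G′ : Fin (suc n) → Poly
  G′ i = G (lookup v i) (a ∷ toList (removeAt v i))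

numH-removeRow : ∀ m n k (λ' : Vec ℕ (suc n)) → AllPairs _≥_ (toList λ') →
  ∑[ i ∈ allFin (suc n) ] (qpow (toℕ i) *P (qpow (lookup λ' i) *P numH m n (toList (removeAt λ' i)) k))
  ≋ (qpow k *P qint (suc n ∸ k)) *P numH m (suc n) (toList λ') k +P qint (k + 1) *P numH m (suc n) (toList λ') (k + 1)
numH-removeRow m n k λ' sorted = begin
  ∑[ i ∈ allFin (suc n) ] (qpow (toℕ i) *P (qpow (lookup λ' i) *P numH m n (toList (removeAt λ' i)) k))
    ≈⟨ ∑-allFin-removeAt n λ' (λ b μ → qpow b *P numH m n μ k) ⟩
  qSum (removals (toList λ')) (λ bμ → qpow (proj₁ bμ) *P numH m n (proj₂ bμ) k)
    ≈⟨ rowRemoval-numH m n k (toList λ') sorted (Vec.length-toList λ') ⟩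
  ∑[ j ∈ upTo (suc n) ] ((weight m j *P qpochCoeff j k) *P (qpow j *P (qint (suc n ∸ j) *P rook j (toList λ'))))
    ≈⟨ shift-numH m (suc n) (toList λ') k ⟨
  (qpow k *P qint (suc n ∸ k)) *P numH m (suc n) (toList λ') k +P qint (k + 1) *P numH m (suc n) (toList λ') (k + 1) ∎
  where open ≋-Reasoning

sumF-≈F : (xs : List A) (fr : A → Frac) (nm : A → Poly) (e : Poly) →
          (∀ x → fr x ≈F nm x / e) → sumF (map fr xs) ≈F ∑ xs nm / e
sumF-≈F []       fr nm e h = ≈P-refl {[]}
sumF-≈F (x ∷ xs) fr nm e h = get (begin
  (a *P d +P c *P b) *P e       ≈⟨ distrib a b c d e ⟩
  (a *P e) *P d +P (c *P e) *P b ≈⟨ +-cong (*-congʳ {d} head) (*-congʳ {b} tail) ⟩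
  (nm x *P b) *P d +P (∑ xs nm *P d) *P b ≈⟨ factor (nm x) b (∑ xs nm) d ⟩
  (nm x +P ∑ xs nm) *P (b *P d)  ∎)
  where
  open ≋-Reasoning
  a = num (fr x)
  b = den (fr x)
  c = num (sumF (map fr xs))
  d = den (sumF (map fr xs))
  head : a *P e ≋ nm x *P b
  head = mk (h x)
  tail : c *P e ≋ ∑ xs nm *P d
  tail = mk (sumF-≈F xs fr nm e h)
  distrib : ∀ a b c d e → (a *P d +P c *P b) *P e ≋ (a *P e) *P d +P (c *P e) *P b
  distrib = solve-∀ Poly-ring
  factor : ∀ n b s d → (n *P b) *P d +P (s *P d) *P b ≋ (n +P s) *P (b *P d)
  factor = solve-∀ Poly-ring

H-removeRow-≈F : ∀ m n k (λ' : Vec ℕ (suc n)) (i : Fin (suc n)) →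
  qpow (toℕ i) ⋆F H m n (removeRow λ' i) k
  ≈F (qpow (toℕ i) *P (qpow (lookup λ' i) *P numH m n (toList (removeAt λ' i)) k)) / (qpow (size λ') *P qfact (m ∸ n))
H-removeRow-≈F m n k λ' i = get (begin
  (qi *P h) *P (qpow (size λ') *P F)     ≡⟨ cong (λ s → (qi *P h) *P (qpow s *P F)) (size-removeAt n λ' i) ⟩
  (qi *P h) *P (qpow (b + s) *P F)       ≈⟨ *-congˡ {qi *P h} (*-congʳ {F} (qpow-+ b s)) ⟩
  (qi *P h) *P ((qpow b *P qpow s) *P F) ≈⟨ regroup qi h (qpow b) (qpow s) F ⟩
  (qi *P (qpow b *P h)) *P (qpow s *P F) ∎)
  where
  open ≋-Reasoning
  qi = qpow (toℕ i)
  h = numH m n (toList (removeAt λ' i)) k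
  b = lookup λ' i
  s = size (removeAt λ' i)
  F = qfact (m ∸ n)
  regroup : ∀ u h v w F → (u *P h) *P ((v *P w) *P F) ≋ (u *P (v *P h)) *P (w *P F)
  regroup = solve-∀ Poly-ring

qfact-∸ : ∀ m n → n < m → qfact (m ∸ n) ≡ qint (m ∸ suc n + 1) *P qfact (m ∸ suc n)
qfact-∸ m n n<m = trans (cong qfact (∸-suc m n n<m)) (cong (λ x → qint x *P qfact (m ∸ suc n)) (ℕ.+-comm 1 (m ∸ suc n)))

lemma3p7 : (m n k : ℕ) → (λ' : Vec ℕ (suc n)) → k ≤ suc n → suc n ≤ m →
    InsideBoard (suc n) m λ' →
    qint (m ∸ suc n + 1) ⋆F sumF (map (λ i → qpow (toℕ i) ⋆F H m n (removeRow λ' i) k) (allFin (suc n)))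
    ≈F (qpow k *P qint (suc n ∸ k)) ⋆F H m (suc n) λ' k +F qint (k + 1) ⋆F H m (suc n) λ' (k + 1)
lemma3p7 m n k λ' _ n<m (decreasing , _) = get (begin
  (qI *P num S) *P (D *P D)                          ≈⟨ regroup (qpow (size λ')) qI F (num S) ⟩
  (num S *P (qpow (size λ') *P (qI *P F))) *P D       ≡⟨ cong (λ f → (num S *P (qpow (size λ') *P f)) *P D) (qfact-∸ m n n<m) ⟨
  (num S *P E) *P D                                  ≈⟨ *-congʳ {D} sum-identity ⟩
  (∑ (allFin (suc n)) Nf *P den S) *P D              ≈⟨ *-congʳ {D} (*-congʳ {den S} (numH-removeRow m n k λ' (Decreasing⇒AllPairs λ' decreasing))) ⟩
  ((Aₖ *P hₖ +P Bₖ *P hₖ₊₁) *P den S) *P D           ≈⟨ distrib (Aₖ *P hₖ) (Bₖ *P hₖ₊₁) (den S) D ⟩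
  ((Aₖ *P hₖ) *P D +P (Bₖ *P hₖ₊₁) *P D) *P den S    ∎)
  where
  open ≋-Reasoning
  S = sumF (map (λ i → qpow (toℕ i) ⋆F H m n (removeRow λ' i) k) (allFin (suc n)))
  qI = qint (m ∸ suc n + 1)
  F = qfact (m ∸ suc n)
  D = qpow (size λ') *P F
  E = qpow (size λ') *P qfact (m ∸ n)
  Aₖ = qpow k *P qint (suc n ∸ k)
  Bₖ = qint (k + 1)
  hₖ = numH m (suc n) (toList λ') k
  hₖ₊₁ = numH m (suc n) (toList λ') (k + 1)
  Nf : Fin (suc n) → Poly
  Nf i = qpow (toℕ i) *P (qpow (lookup λ' i) *P numH m n (toList (removeAt λ' i)) k)
  sum-identity : num S *P E ≋ ∑ (allFin (suc n)) Nf *P den S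
  sum-identity = mk (sumF-≈F (allFin (suc n)) (λ i → qpow (toℕ i) ⋆F H m n (removeRow λ' i) k) Nf E (H-removeRow-≈F m n k λ'))
  regroup : ∀ u q f s → (q *P s) *P ((u *P f) *P (u *P f)) ≋ (s *P (u *P (q *P f))) *P (u *P f)
  regroup = solve-∀ Poly-ring
  distrib : ∀ x y s d → ((x +P y) *P s) *P d ≋ (x *P d +P y *P d) *P s
  distrib = solve-∀ Poly-ring
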